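{- If $\ell$ is a well-typed let-term and $\ell\to_S\ell'$, then $\mathrm{Facts}(\ell')=\mathrm{Facts}(\ell)$.
   Context: Types: positive $P,Q::=\mathsf{Bool}\mid P\otimes Q$; arrow $N::=P\multimap T$; let-term types $T,U::=P\mid N\mid P\otimes T$. Each variable carries a fixed type $\mathsf{ty}(v)$, positive or arrow; $x,y,z$ positive variables, $f,g,h$ arrow variables. Webs: $|\mathsf{Bool}|=\{\mathsf t,\mathsf f\}$, $|P\otimes T|=|P\multimap T|=|P|\times|T|$. Constants $M$: stochastic matrices in $\mathbb R_{\ge0}^{|P|\times|Q|}$ of type $P\multimap Q$ (or $0$-ary probability vectors of type $Q$). Syntax: patterns $\vec v::=v\mid(\vec v,\vec v')$ (components with disjoint variables); expressions $e::=v\mid M(\vec x)\mid f\,\vec x\mid (e,e')\mid \lambda\vec x.e\mid \mathtt{let}\ \vec v=e\ \mathtt{in}\ e'$ ($\vec x$ positive pattern); let-terms $\ell::=\vec v\mid \mathtt{let}\ \vec v=e\ \mathtt{in}\ \ell$. Typing: $v:\mathsf{ty}(v)$; $f:P\multimap T,\vec x:P\Rightarrow f\vec x:T$; $M:P\multimap Q,\vec x:P\Rightarrow M(\vec x):Q$; $\vec x:P,e:T\Rightarrow\lambda\vec x.e:P\multimap T$; $e:P,e':T$, $FV^a(e)\cap FV^a(e')=\emptyset\Rightarrow(e,e'):P\otimes T$; $\vec v:T,e:T,e':U$, $FV^a(e)\cap FV^a(e')=\emptyset$, each arrow variable of $\vec v$ in $FV^a(e')$ $\Rightarrow\mathtt{let}\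 \vec v=e\ \mathtt{in}\ e':U$. $\vec v^a$: the arrow variable of a pattern (at most one); $\vec v^+$: the pattern without it. $(\vec v_1=e_1;\vec v_2=e_2\ \mathtt{in}\ \ell)$ abbreviates nested lets; the last pattern of a let-term is its output. Bound variables pairwise distinct and distinct from free ones. Semantics: $|V|=\prod_{v\in V}|\mathsf{ty}(v)|$ (functions; restriction $a|_{V'}$; union $a\uplus b$); elements of $|FV(\vec v)|$ identified with $|\mathsf{ty}(\vec v)|$. $[\![e]\!]\in\mathbb R_{\ge0}^{|FV(e)|\times|\mathsf{ty}(e)|}$: $[\![v]\!]_{a,b}=\delta_{a_v,b}$; $[\![(e',e'')]\!]_{a,(b',b'')}=[\![e']\!]_{a|_{FV(e')},b'}[\![e'']\!]_{a|_{FV(e'')},b''}$; $[\![\mathtt{let}\ \vec v=e'\ \mathtt{in}\ e'']\!]_{a,b}=\sum_{c\in|FV(\vec v)|}[\![e']\!]_{a|_{FV(e')},c}[\![e'']\!]_{(a\uplus c)|_{FV(e'')},b}$; $[\![\lambda\vec v.e']\!]_{a,(b',b'')}=[\![e']\!]_{(a\uplus b')|_{FV(e')},b''}$; $[\![M(\vec x)]\!]_{a,b}=M_{a,b}$; $[\![f\vec x]\!]_{a,b}=\delta_{a',a'''}\delta_{a'',b}$ with $a_f=(a',a'')$, $a|_{\vec x}=a'''$. Factors: pairs $(\mathrm{Var}(\varphi),\varphi:|\mathrm{Var}(\varphi)|\to\mathbb R_{\ge0})$; $\mathrm{Var}(\sum_S\varphi)=\mathrm{Var}(\varphi)\setminus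 S$, $(\sum_S\varphi)(a)=\sum_{b\in|S\cap\mathrm{Var}(\varphi)|}\varphi(a\uplus b)$; $\mathrm{Var}(\varphi\odot\psi)=\mathrm{Var}(\varphi)\cup\mathrm{Var}(\psi)$, $(\varphi\odot\psi)(c)=\varphi(c|_{\mathrm{Var}(\varphi)})\psi(c|_{\mathrm{Var}(\psi)})$. For a finite set $\Gamma$ of factors, $\bigodot\Gamma$ is their product, $\Gamma_V=\{\varphi\in\Gamma:\mathrm{Var}(\varphi)\cap V\ne\emptyset\}$, $\Gamma_{\neg V}=\Gamma\setminus\Gamma_V$. $\mathrm{Fact}(\vec v=e)$: variables $FV(e)\uplus FV(\vec v)$, function $a\uplus c\mapsto[\![e]\!]_{a,c}$. $\mathrm{Facts}(\vec w)=\{(FV(\vec w),a\mapsto1)\}$; for $\ell$ with output $\vec w$, $\mathrm{Facts}(\mathtt{let}\ \vec v=e\ \mathtt{in}\ \ell)=\{\sum_{\{f\}}(\mathrm{Fact}(\vec v=e)\odot\bigodot\mathrm{Facts}(\ell)_f)\}\uplus\mathrm{Facts}(\ell)_{\neg f}$ if $\vec v$ contains an arrow variable $f\notin FV(\vec w)$, and $\{\mathrm{Fact}(\vec v=e)\}\uplus\mathrm{Facts}(\ell)$ otherwise. Bound variable names are used as factor variable names. Swap rewriting $\to_S$: one application (to the let-term or to one of its tails) of: ($S_1$) $(\vec v_1=e_1;\vec v_2=e_2\ \mathtt{in}\ \ell)\to(\vec v_2=e_2;\vec v_1=e_1\ \mathtt{in}\ \ell)$ if $FV(\vec v_1)\cap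 FV(e_2)=\emptyset$; ($S_2$) $(\vec v_1=e_1;\vec v_2=e_2\ \mathtt{in}\ \ell)\to(f=\lambda\vec x.e_2;\vec v_1=e_1;\vec v_2=f\vec x\ \mathtt{in}\ \ell)$ ($f$ fresh arrow variable) if $\vec x=FV(\vec v_1)\cap FV(e_2)$ is positive and non-empty; ($S_3$) $(\vec v_1=e_1;\vec v_2=e_2\ \mathtt{in}\ \ell)\to((\vec v_1^+,\vec v_2)=(\mathtt{let}\ \vec v_1=e_1\ \mathtt{in}\ (\vec v_1^+,e_2))\ \mathtt{in}\ \ell)$ if $\vec v_1^a=f$ with $f\in FV(e_2)$ (if $\vec v_1^+$ is empty, $(\vec v_1^+,e)$ stands for $e$). -}

module Defs where

-- Scalars are taken in an arbitrary commutative
-- semiring R (the paper uses R = nonnegative reals).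

open import Level using (_⊔_)
open import Algebra.Bundles using (CommutativeSemiring)
open import Data.Nat using (ℕ)
open import Data.Bool using (Bool; true; false; if_then_else_)
open import Data.Product using (Σ; _×_; _,_; proj₁; proj₂)
open import Data.Product.Properties using (≡-dec)
open import Data.List using (List; []; _∷_; _++_; map; foldr; filter; cartesianProductWith)
open import Data.List.Relation.Unary.All using (All)
open import Data.List.Relation.Unary.Any using (Any)
open import Data.List.Relation.Unary.Unique.Propositional using (Unique)
open import Data.Maybe using (Maybe; just; nothing; _<∣>_)
open import Data.Empty using (⊥)
open import Data.Sum using (_⊎_)
open import Relation.Nullary using (¬_; Dec; yes; no; ¬?; does)
open import Relation.Binary.PropositionalEquality using (_≡_; refl; cong; cong₂)
open import Relation.Binary.Definitions using (DecidableEquality)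
import Data.Nat.Properties as ℕP

-- Types.  One grammar; positivity / let-term-type are predicates.

infixr 6 _⊗_
infixr 5 _⊸_

data Ty : Set where
  𝔹   : Ty
  _⊗_ : Ty → Ty → Ty
  _⊸_ : Ty → Ty → Ty

_≟Ty_ : DecidableEquality Ty
𝔹 ≟Ty 𝔹 = yes refl
𝔹 ≟Ty (_ ⊗ _) = no λ ()
𝔹 ≟Ty (_ ⊸ _) = no λ ()
(_ ⊗ _) ≟Ty 𝔹 = no λ ()
(_ ⊸ _) ≟Ty 𝔹 = no λ ()
(_ ⊗ _) ≟Ty (_ ⊸ _) = no λ ()
(_ ⊸ _) ≟Ty (_ ⊗ _) = no λ ()
(a ⊗ b) ≟Ty (c ⊗ d) with a ≟Ty c | b ≟Ty d
... | yes refl | yes refl = yes refl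
... | no p | _ = no λ { refl → p refl }
... | yes _ | no q = no λ { refl → q refl }
(a ⊸ b) ≟Ty (c ⊸ d) with a ≟Ty c | b ≟Ty d
... | yes refl | yes refl = yes refl
... | no p | _ = no λ { refl → p refl }
... | yes _ | no q = no λ { refl → q refl }

data Pos : Ty → Set where
  pos-𝔹 : Pos 𝔹
  pos-⊗ : ∀ {P Q} → Pos P → Pos Q → Pos (P ⊗ Q)

data LetTy : Ty → Set where
  lt-pos : ∀ {P} → Pos P → LetTy P
  lt-arr : ∀ {P T} → Pos P → LetTy T → LetTy (P ⊸ T)
  lt-⊗   : ∀ {P T} → Pos P → LetTy T → LetTy (P ⊗ T)

data ArrTy : Ty → Set where
  arr : ∀ {P T} → Pos P → LetTy T → ArrTy (P ⊸ T)

VarTy : Ty → Set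
VarTy A = Pos A ⊎ ArrTy A

isArr : Ty → Bool
isArr (_ ⊸ _) = true
isArr _       = false

-- Webs.  Web elements are represented by untyped values with a typing
-- predicate; |Bool| = {t,f}, |A ⊗ B| = |A ⊸ B| = |A| × |B|.

data Val : Set where
  vt vf : Val
  ⟨_,_⟩ : Val → Val → Val

_≟Val_ : DecidableEquality Val
vt ≟Val vt = yes refl
vf ≟Val vf = yes refl
vt ≟Val vf = no λ ()
vf ≟Val vt = no λ ()
vt ≟Val ⟨ _ , _ ⟩ = no λ ()
vf ≟Val ⟨ _ , _ ⟩ = no λ ()
⟨ _ , _ ⟩ ≟Val vt = no λ ()
⟨ _ , _ ⟩ ≟Val vf = no λ ()
⟨ a , b ⟩ ≟Val ⟨ c , d ⟩ with a ≟Val c | b ≟Val d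
... | yes refl | yes refl = yes refl
... | no p | _ = no λ { refl → p refl }
... | yes _ | no q = no λ { refl → q refl }

data InWeb : Ty → Val → Set where
  w-t : InWeb 𝔹 vt
  w-f : InWeb 𝔹 vf
  w-⊗ : ∀ {A B a b} → InWeb A a → InWeb B b → InWeb (A ⊗ B) ⟨ a , b ⟩
  w-⊸ : ∀ {A B a b} → InWeb A a → InWeb B b → InWeb (A ⊸ B) ⟨ a , b ⟩

elems : Ty → List Val
elems 𝔹       = vt ∷ vf ∷ []
elems (A ⊗ B) = cartesianProductWith ⟨_,_⟩ (elems A) (elems B)
elems (A ⊸ B) = cartesianProductWith ⟨_,_⟩ (elems A) (elems B)

Var : Set
Var = ℕ × Ty

ty : Var → Ty
ty = proj₂

_≟V_ : DecidableEquality Var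
_≟V_ = ≡-dec ℕP._≟_ _≟Ty_

open import Data.List.Membership.Propositional using (_∈_; _∉_)
open import Data.List.Membership.DecPropositional _≟V_ using (_∈?_)

Disjoint : List Var → List Var → Set
Disjoint xs ys = ∀ {v} → v ∈ xs → v ∈ ys → ⊥

_∖_ : List Var → List Var → List Var
xs ∖ ys = filter (λ v → ¬? (v ∈? ys)) xs

arrows : List Var → List Var
arrows = filter (λ v → isArr (ty v) ≟Bool true)
  where
  _≟Bool_ : DecidableEquality Bool
  true ≟Bool true = yes refl
  false ≟Bool false = yes refl
  true ≟Bool false = no λ ()
  false ≟Bool true = no λ ()

data Pat : Set where
  pv : Var → Pat
  pp : Pat → Pat → Pat

pvars : Pat → List Var
pvars (pv v)   = v ∷ []
pvars (pp p q) = pvars p ++ pvars q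

pty : Pat → Ty
pty (pv v)   = ty v
pty (pp p q) = pty p ⊗ pty q

data WfPat : Pat → Set where
  wf-v : ∀ {v} → VarTy (ty v) → WfPat (pv v)
  wf-p : ∀ {p q} → WfPat p → WfPat q → Pos (pty p) →
         Disjoint (pvars p) (pvars q) → WfPat (pp p q)

arrowVar : Pat → Maybe Var
arrowVar (pv v)   = if isArr (ty v) then just v else nothing
arrowVar (pp p q) = arrowVar p <∣> arrowVar q

-- the pattern without its arrow variable (vec v ^+); nothing = empty
posPart : Pat → Maybe Pat
posPart (pv v) = if isArr (ty v) then nothing else just (pv v)
posPart (pp p q) = comb (posPart p) (posPart q)
  where
  comb : Maybe Pat → Maybe Pat → Maybe Pat
  comb (just a) (just b) = just (pp a b)
  comb (just a) nothing  = just a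
  comb nothing  r        = r

Env : Set
Env = Var → Val

TypedEnv : Env → Set
TypedEnv ρ = ∀ v → InWeb (ty v) (ρ v)

_[_↦_] : Env → Var → Val → Env
(ρ [ v ↦ w ]) u = if does (u ≟V v) then w else ρ u

patVal : Pat → Env → Val
patVal (pv v)   ρ = ρ v
patVal (pp p q) ρ = ⟨ patVal p ρ , patVal q ρ ⟩

bind : Pat → Val → Env → Env
bind (pv v)   w           ρ = ρ [ v ↦ w ]
bind (pp p q) ⟨ w₁ , w₂ ⟩ ρ = bind q w₂ (bind p w₁ ρ)
bind (pp p q) _           ρ = ρ

module Lang {c ℓ} (R : CommutativeSemiring c ℓ) where

  open CommutativeSemiring R renaming (Carrier to C)

  sumC : List C → C
  sumC = foldr _+_ 0#

  δ : Val → Val → C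
  δ a b = if does (a ≟Val b) then 1# else 0#

  record Const : Set (c ⊔ ℓ) where
    field
      dom cod    : Ty
      dom-pos    : Pos dom
      cod-pos    : Pos cod
      mat        : Val → Val → C
      stochastic : ∀ a → InWeb dom a → sumC (map (mat a) (elems cod)) ≈ 1#

  record Const₀ : Set (c ⊔ ℓ) where
    field
      cod        : Ty
      cod-pos    : Pos cod
      vec        : Val → C
      stochastic : sumC (map vec (elems cod)) ≈ 1#

  open Const
  open Const₀

  data Expr : Set (c ⊔ ℓ) where
    var  : Var → Expr
    cst  : Const → Pat → Expr
    cst₀ : Const₀ → Expr
    app  : Var → Pat → Expr
    pair : Expr → Expr → Expr
    lam  : Pat → Expr → Expr
    elet : Pat → Expr → Expr → Expr

  patExpr : Pat → Expr
  patExpr (pv v)   = var v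
  patExpr (pp p q) = pair (patExpr p) (patExpr q)

  FV : Expr → List Var
  FV (var v)      = v ∷ []
  FV (cst _ x)    = pvars x
  FV (cst₀ _)     = []
  FV (app f x)    = f ∷ pvars x
  FV (pair e e')  = FV e ++ FV e'
  FV (lam x e)    = FV e ∖ pvars x
  FV (elet v e e') = FV e ++ (FV e' ∖ pvars v)

  FVa : Expr → List Var
  FVa e = arrows (FV e)

  BV : Expr → List Var
  BV (var _)      = []
  BV (cst _ _)    = []
  BV (cst₀ _)     = []
  BV (app _ _)    = []
  BV (pair e e')  = BV e ++ BV e'
  BV (lam x e)    = pvars x ++ BV e
  BV (elet v e e') = pvars v ++ BV e ++ BV e'

  infix 4 _∶_
  data _∶_ : Expr → Ty → Set (c ⊔ ℓ) where
    t-var  : ∀ {v} → VarTy (ty v) → var v ∶ ty v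
    t-cst  : ∀ {M x} → WfPat x → pty x ≡ dom M → cst M x ∶ cod M
    t-cst₀ : ∀ {D} → cst₀ D ∶ Const₀.cod D
    t-app  : ∀ {f x P T} → VarTy (ty f) → ty f ≡ P ⊸ T →
             WfPat x → pty x ≡ P → app f x ∶ T
    t-pair : ∀ {e e' P T} → e ∶ P → Pos P → e' ∶ T →
             Disjoint (FVa e) (FVa e') → pair e e' ∶ P ⊗ T
    t-lam  : ∀ {x e T} → WfPat x → Pos (pty x) → e ∶ T →
             lam x e ∶ pty x ⊸ T
    t-let  : ∀ {v e e' U} → WfPat v → e ∶ pty v → e' ∶ U →
             Disjoint (FVa e) (FVa e') →
             (∀ {g} → g ∈ arrows (pvars v) → g ∈ FVa e') →
             elet v e e' ∶ U

  appSem : Val → Val → Val → C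
  appSem ⟨ a' , a'' ⟩ a''' b = δ a' a''' * δ a'' b
  appSem _            _    _ = 0#

  ⟦_⟧ : Expr → Env → Val → C
  ⟦ var v ⟧ ρ b = δ (ρ v) b
  ⟦ cst M x ⟧ ρ b = mat M (patVal x ρ) b
  ⟦ cst₀ D ⟧ ρ b = vec D b
  ⟦ app f x ⟧ ρ b = appSem (ρ f) (patVal x ρ) b
  ⟦ pair e e' ⟧ ρ ⟨ b' , b'' ⟩ = ⟦ e ⟧ ρ b' * ⟦ e' ⟧ ρ b''
  ⟦ pair e e' ⟧ ρ _ = 0#
  ⟦ lam x e ⟧ ρ ⟨ b' , b'' ⟩ = ⟦ e ⟧ (bind x b' ρ) b''
  ⟦ lam x e ⟧ ρ _ = 0#
  ⟦ elet v e e' ⟧ ρ b =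
    sumC (map (λ w → ⟦ e ⟧ ρ w * ⟦ e' ⟧ (bind v w ρ) b) (elems (pty v)))

  data LetT : Set (c ⊔ ℓ) where
    out  : Pat → LetT
    lett : Pat → Expr → LetT → LetT

  toExpr : LetT → Expr
  toExpr (out w)      = patExpr w
  toExpr (lett v e l) = elet v e (toExpr l)

  output : LetT → Pat
  output (out w)      = w
  output (lett _ _ l) = output l

  -- well-typed let-term, with the convention that bound variables are
  -- pairwise distinct and distinct from free ones
  WellTyped : LetT → Set (c ⊔ ℓ)
  WellTyped l = Σ Ty (λ U → toExpr l ∶ U)
              × Unique (BV (toExpr l))
              × Disjoint (BV (toExpr l)) (FV (toExpr l))

  record Factor : Set c where
    constructor factor
    field
      fvars : List Var
      fn    : Env → C
  open Factor

  _⊙_ : Factor → Factor → Factor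
  φ ⊙ ψ = factor (fvars φ ++ fvars ψ) (λ ρ → fn φ ρ * fn ψ ρ)

  ⨀ : List Factor → Factor
  ⨀ = foldr _⊙_ (factor [] (λ _ → 1#))

  Σ[_]_ : Var → Factor → Factor
  Σ[ f ] φ = factor (fvars φ ∖ (f ∷ []))
    (λ ρ → if does (f ∈? fvars φ)
             then sumC (map (λ w → fn φ (ρ [ f ↦ w ])) (elems (ty f)))
             else fn φ ρ)

  Fact : Pat → Expr → Factor
  Fact v e = factor (FV e ++ pvars v) (λ ρ → ⟦ e ⟧ ρ (patVal v ρ))

  mentions : Var → List Factor → List Factor
  mentions f = filter (λ φ → f ∈? fvars φ)

  avoids : Var → List Factor → List Factor
  avoids f = filter (λ φ → ¬? (f ∈? fvars φ))

  factsLet : Pat → Expr → Pat → List Factor → List Factor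
  factsLet v e w Γ with arrowVar v
  ... | nothing = Fact v e ∷ Γ
  ... | just f with f ∈? pvars w
  ...   | yes _ = Fact v e ∷ Γ
  ...   | no  _ = (Σ[ f ] (Fact v e ⊙ ⨀ (mentions f Γ))) ∷ avoids f Γ

  Facts : LetT → List Factor
  Facts (out w)      = factor (pvars w) (λ _ → 1#) ∷ []
  Facts (lett v e l) = factsLet v e (output l) (Facts l)

  -- equality of factors: same variable set, same function on |Var(φ)|
  -- (functions are compared on well-typed environments)
  _≈F_ : Factor → Factor → Set ℓ
  φ ≈F ψ = (∀ v → (v ∈ fvars φ → v ∈ fvars ψ) × (v ∈ fvars ψ → v ∈ fvars φ))
         × (∀ ρ → TypedEnv ρ → fn φ ρ ≈ fn ψ ρ)

  _≋_ : List Factor → List Factor → Set (c ⊔ ℓ)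
  Γ ≋ Δ = All (λ φ → Any (φ ≈F_) Δ) Γ × All (λ ψ → Any (ψ ≈F_) Γ) Δ

  -- Swap rewriting.  G = variables of the whole term (for freshness).

  pairPat : Maybe Pat → Pat → Pat
  pairPat nothing  q = q
  pairPat (just p) q = pp p q

  pairExpr : Maybe Pat → Expr → Expr
  pairExpr nothing  e = e
  pairExpr (just p) e = pair (patExpr p) e

  data Step (G : List Var) : LetT → LetT → Set (c ⊔ ℓ) where
    S₁ : ∀ {v₁ e₁ v₂ e₂ l} →
         Disjoint (pvars v₁) (FV e₂) →
         Step G (lett v₁ e₁ (lett v₂ e₂ l)) (lett v₂ e₂ (lett v₁ e₁ l))
    S₂ : ∀ {v₁ e₁ v₂ e₂ l} (x : Pat) (f : Var) →
         WfPat x → Pos (pty x) →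
         (∀ y → (y ∈ pvars x → y ∈ pvars v₁ × y ∈ FV e₂)
              × (y ∈ pvars v₁ → y ∈ FV e₂ → y ∈ pvars x)) →
         ty f ≡ pty x ⊸ pty v₂ → f ∉ G →
         Step G (lett v₁ e₁ (lett v₂ e₂ l))
                (lett (pv f) (lam x e₂) (lett v₁ e₁ (lett v₂ (app f x) l)))
    S₃ : ∀ {v₁ e₁ v₂ e₂ l f} →
         arrowVar v₁ ≡ just f → f ∈ FV e₂ →
         Step G (lett v₁ e₁ (lett v₂ e₂ l))
                (lett (pairPat (posPart v₁) v₂)
                      (elet v₁ e₁ (pairExpr (posPart v₁) e₂)) l)
    tail : ∀ {v e l l'} → Step G l l' → Step G (lett v e l) (lett v e l')

  allVars : LetT → List Var
  allVars l = BV (toExpr l) ++ FV (toExpr l)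

  infix 4 _⟶S_
  _⟶S_ : LetT → LetT → Set (c ⊔ ℓ)
  l ⟶S l' = Step (allVars l) l l'

{-# OPTIONS --safe #-}
module Submission where

-- We show that Facts(ℓ') is a permutation of Facts(ℓ) up to factor equality: unlike
-- set equality, this is respected by the products formed when summing out, so it passes
-- through the binding in front of a rewritten tail.
--
-- S₁ exchanges independent bindings, and adding their factors commutes; if both bindings sum
-- out arrow variables g₁, g₂ occurring in a common later factor, both orders yield
-- Σ_g₁ Σ_g₂ of the product of all factors touching g₁ or g₂. For S₂ and S₃, one side of the
-- step has a binding with arrow variable f and factor Λ, f occurs in exactly one factor Ψ of
-- the later bindings, and Σ_f (Λ ⊙ Ψ) is the factor of the corresponding binding on the other
-- side: by β-reduction, Σ_f [[λx.e₂]] [[f x]] = [[e₂]], for S₂, and by the semantics of let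
-- for S₃. Later bindings either leave Ψ alone or absorb it into a product with factors avoiding
-- f, and summing out f commutes with that, so eliminating f turns one side's facts into the
-- other's.

open import Level using (_⊔_)
open import Algebra.Bundles using (CommutativeSemiring; CommutativeMonoid)
import Algebra.Properties.CommutativeSemigroup as CommutativeSemigroupProperties
open import Function using (_∘_; id; case_of_)
open import Data.Bool using (true; false)
import Data.Bool.Properties as Bool
open import Data.Empty using (⊥-elim)
open import Data.Maybe using (Maybe; just; nothing; _<∣>_)
import Data.Product
open import Data.Product using (_×_; _,_; proj₁; proj₂)
open import Data.Sum using (inj₁; inj₂; [_,_])
open import Data.List using (List; []; _∷_; _++_; map; filter; cartesianProductWith)
open import Data.List.Properties
  using (map-cong-local; ++-assoc; ++-identityʳ; filter-++; filter-none; filter-all)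
open import Data.List.Relation.Unary.Any as Any using (Any; here; there)
open import Data.List.Relation.Unary.Any.Properties using (singleton⁻)
open import Data.List.Relation.Unary.All as All using (All; []; _∷_)
open import Data.List.Relation.Unary.All.Properties
  using (all-filter) renaming (filter⁺ to All-filter⁺; ++⁺ to All-++⁺)
open import Data.List.Relation.Unary.AllPairs using (_∷_)
open import Data.List.Relation.Unary.Unique.Propositional using (Unique)
open import Data.List.Membership.Propositional using (_∈_; _∉_; find)
open import Data.List.Membership.Propositional.Properties
  using (∈-filter⁺; ∈-filter⁻; ∈-++⁺ˡ; ∈-++⁺ʳ; ∈-++⁻; ∈-cartesianProductWith⁻)
open import Data.List.Relation.Binary.Subset.Propositional using (_⊆_)
open import Data.List.Relation.Binary.Subset.Propositional.Properties using (++⁺)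
open import Data.List.Relation.Binary.Permutation.Propositional
  using () renaming (_↭_ to _↭ₚ_; ↭-sym to ↭ₚ-sym; ↭-reflexive to ↭ₚ-reflexive)
open import Data.List.Relation.Binary.Permutation.Propositional.Properties
  using () renaming (∈-resp-↭ to ∈-resp-↭ₚ; ++-comm to ↭ₚ-++-comm)
import Data.List.Relation.Binary.Permutation.Setoid as PermutationSetoid
import Data.List.Relation.Binary.Permutation.Setoid.Properties as PermutationSetoidProperties
open import Relation.Nullary using (yes; no; ¬?)
open import Relation.Nullary.Decidable using (dec-true; dec-false)
open import Relation.Unary using (Decidable)
open import Relation.Binary.Bundles using (Setoid)
open import Relation.Binary.Structures using (IsEquivalence)
import Relation.Binary.Reasoning.Setoid as SetoidReasoning
open import Relation.Binary.PropositionalEquality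
  using (_≡_; _≢_; refl; sym; trans; cong; cong₂; subst; module ≡-Reasoning)

open import Defs
open import Data.List.Membership.DecPropositional _≟V_ using (_∈?_)

-- Variables, environments and patterns

∈-∖⁺ : ∀ {v xs ys} → v ∈ xs → v ∉ ys → v ∈ xs ∖ ys
∈-∖⁺ {ys = ys} = ∈-filter⁺ (λ v → ¬? (v ∈? ys))

∈-∖⁻ : ∀ {v xs ys} → v ∈ xs ∖ ys → v ∈ xs × v ∉ ys
∈-∖⁻ {ys = ys} = ∈-filter⁻ (λ v → ¬? (v ∈? ys))

∖-mono : ∀ {xs ys} zs → xs ⊆ ys → xs ∖ zs ⊆ ys ∖ zs
∖-mono zs xs⊆ys v∈ = let v∈xs , v∉zs = ∈-∖⁻ v∈ in ∈-∖⁺ (xs⊆ys v∈xs) v∉zs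

∉-singleton : ∀ {u v : Var} → u ≢ v → u ∉ v ∷ []
∉-singleton u≢v u∈[v] = u≢v (singleton⁻ u∈[v])

∈-arrows⁺ : ∀ xs {y} → y ∈ xs → isArr (ty y) ≡ true → y ∈ arrows xs
∈-arrows⁺ (x ∷ xs) (here refl) y-arrow rewrite y-arrow = here refl
∈-arrows⁺ (x ∷ xs) (there y∈xs) y-arrow with isArr (ty x)
... | true  = there (∈-arrows⁺ xs y∈xs y-arrow)
... | false = ∈-arrows⁺ xs y∈xs y-arrow

filter-comm : ∀ {a p q} {A : Set a} {P : A → Set p} {Q : A → Set q}
              (P? : Decidable P) (Q? : Decidable Q) xs →
              filter P? (filter Q? xs) ≡ filter Q? (filter P? xs)
filter-comm P? Q? [] = refl
filter-comm P? Q? (x ∷ xs) with P? x in p | Q? x in q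
... | yes _ | yes _ rewrite p | q = cong (x ∷_) (filter-comm P? Q? xs)
... | yes _ | no _  rewrite q     = filter-comm P? Q? xs
... | no _  | yes _ rewrite p     = filter-comm P? Q? xs
... | no _  | no _                = filter-comm P? Q? xs

Unique-++⁻ʳ : ∀ xs {ys : List Var} → Unique (xs ++ ys) → Unique ys
Unique-++⁻ʳ []       u       = u
Unique-++⁻ʳ (x ∷ xs) (_ ∷ u) = Unique-++⁻ʳ xs u

Unique-++⇒Disjoint : ∀ xs {ys : List Var} → Unique (xs ++ ys) → Disjoint xs ys
Unique-++⇒Disjoint (x ∷ xs) (x∉ ∷ _) (here refl) y∈ys = All.lookup x∉ (∈-++⁺ʳ xs y∈ys) refl
Unique-++⇒Disjoint (x ∷ xs) (_ ∷ u)  (there y∈xs) y∈ys = Unique-++⇒Disjoint xs u y∈xs y∈ys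

Agree : List Var → Env → Env → Set
Agree S ρ ρ' = ∀ {u} → u ∈ S → ρ u ≡ ρ' u

↦-same : ∀ ρ v w → (ρ [ v ↦ w ]) v ≡ w
↦-same ρ v w with v ≟V v
... | yes _  = refl
... | no v≢v = ⊥-elim (v≢v refl)

↦-other : ∀ ρ {u v} w → u ≢ v → (ρ [ v ↦ w ]) u ≡ ρ u
↦-other ρ {u} {v} w u≢v with u ≟V v
... | yes u≡v = ⊥-elim (u≢v u≡v)
... | no _    = refl

↦-cong : ∀ {ρ ρ'} u v w → ρ u ≡ ρ' u → (ρ [ v ↦ w ]) u ≡ (ρ' [ v ↦ w ]) u
↦-cong u v w eq with u ≟V v
... | yes _ = refl
... | no _  = eq

↦-comm : ∀ ρ {g h} a b → g ≢ h → ∀ u → ((ρ [ g ↦ a ]) [ h ↦ b ]) u ≡ ((ρ [ h ↦ b ]) [ g ↦ a ]) u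
↦-comm ρ {g} {h} a b g≢h u with u ≟V h | u ≟V g
... | yes refl | yes refl = ⊥-elim (g≢h refl)
... | yes refl | no _     = refl
... | no _     | yes refl = refl
... | no _     | no _     = refl

↦-typed : ∀ {ρ} v {w} → TypedEnv ρ → InWeb (ty v) w → TypedEnv (ρ [ v ↦ w ])
↦-typed v ρ-typed w-typed u with u ≟V v
... | yes refl = w-typed
... | no _     = ρ-typed u

↦-agree : ∀ xs g w {ρ ρ'} → Agree (xs ∖ (g ∷ [])) ρ ρ' → Agree xs (ρ [ g ↦ w ]) (ρ' [ g ↦ w ])
↦-agree xs g w ag {u} u∈ with u ≟V g
... | yes _   = refl
... | no u≢g  = ag (∈-∖⁺ u∈ (∉-singleton u≢g))

↦-agree-∉ : ∀ xs g w ρ → g ∉ xs → Agree xs (ρ [ g ↦ w ]) ρ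
↦-agree-∉ xs g w ρ g∉ {u} u∈ = ↦-other ρ w (λ u≡g → g∉ (subst (_∈ xs) u≡g u∈))

∈-elems⁻ : ∀ A {w} → w ∈ elems A → InWeb A w
∈-elems⁻ 𝔹 (here refl)         = w-t
∈-elems⁻ 𝔹 (there (here refl)) = w-f
∈-elems⁻ (A ⊗ B) w∈ with ∈-cartesianProductWith⁻ ⟨_,_⟩ (elems A) (elems B) w∈
... | _ , _ , a∈ , b∈ , refl = w-⊗ (∈-elems⁻ A a∈) (∈-elems⁻ B b∈)
∈-elems⁻ (A ⊸ B) w∈ with ∈-cartesianProductWith⁻ ⟨_,_⟩ (elems A) (elems B) w∈
... | _ , _ , a∈ , b∈ , refl = w-⊸ (∈-elems⁻ A a∈) (∈-elems⁻ B b∈)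

patVal-cong : ∀ x {ρ ρ'} → Agree (pvars x) ρ ρ' → patVal x ρ ≡ patVal x ρ'
patVal-cong (pv v)   ag = ag (here refl)
patVal-cong (pp p q) ag =
  cong₂ ⟨_,_⟩ (patVal-cong p (ag ∘ ∈-++⁺ˡ)) (patVal-cong q (ag ∘ ∈-++⁺ʳ (pvars p)))

patVal-typed : ∀ x {ρ} → TypedEnv ρ → InWeb (pty x) (patVal x ρ)
patVal-typed (pv v)   ρ-typed = ρ-typed v
patVal-typed (pp p q) ρ-typed = w-⊗ (patVal-typed p ρ-typed) (patVal-typed q ρ-typed)

bind-cong : ∀ x b {ρ ρ'} u → ρ u ≡ ρ' u → bind x b ρ u ≡ bind x b ρ' u
bind-cong (pv v)   b {ρ} {ρ'} u eq = ↦-cong {ρ} {ρ'} u v b eq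
bind-cong (pp p q) vt            u eq = eq
bind-cong (pp p q) vf            u eq = eq
bind-cong (pp p q) ⟨ b₁ , b₂ ⟩ {ρ} {ρ'} u eq =
  bind-cong q b₂ {bind p b₁ ρ} {bind p b₁ ρ'} u (bind-cong p b₁ u eq)

bind-∈ : ∀ x {b} ρ ρ' {u} → InWeb (pty x) b → u ∈ pvars x → bind x b ρ u ≡ bind x b ρ' u
bind-∈ (pv v) ρ ρ' _ (here refl) = trans (↦-same ρ v _) (sym (↦-same ρ' v _))
bind-∈ (pp p q) ρ ρ' {u} (w-⊗ b₁ b₂) u∈ with ∈-++⁻ (pvars p) u∈
... | inj₁ u∈p = bind-cong q _ {bind p _ ρ} {bind p _ ρ'} u (bind-∈ p ρ ρ' b₁ u∈p)
... | inj₂ u∈q = bind-∈ q _ _ b₂ u∈q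

bind-∉ : ∀ x b ρ {u} → u ∉ pvars x → bind x b ρ u ≡ ρ u
bind-∉ (pv v)   b             ρ u∉ = ↦-other ρ b (u∉ ∘ here)
bind-∉ (pp p q) vt            ρ u∉ = refl
bind-∉ (pp p q) vf            ρ u∉ = refl
bind-∉ (pp p q) ⟨ b₁ , b₂ ⟩ ρ u∉ =
  trans (bind-∉ q b₂ _ (u∉ ∘ ∈-++⁺ʳ (pvars p))) (bind-∉ p b₁ ρ (u∉ ∘ ∈-++⁺ˡ))

bind-agree : ∀ x {b} → InWeb (pty x) b → ∀ {S ρ ρ'} →
             Agree (S ∖ pvars x) ρ ρ' → Agree S (bind x b ρ) (bind x b ρ')
bind-agree x b-typed {ρ = ρ} {ρ'} ag {u} u∈S with u ∈? pvars x
... | yes u∈x = bind-∈ x ρ ρ' b-typed u∈x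
... | no u∉x  = bind-cong x _ {ρ} {ρ'} u (ag (∈-∖⁺ u∈S u∉x))

bind-patVal : ∀ x {ρ σ} → (∀ u → σ u ≡ ρ u) → ∀ u → bind x (patVal x ρ) σ u ≡ ρ u
bind-patVal (pv v) {ρ} {σ} σ≗ρ u with u ≟V v
... | yes refl = refl
... | no _     = σ≗ρ u
bind-patVal (pp p q) σ≗ρ = bind-patVal q (bind-patVal p σ≗ρ)

patVal-bind : ∀ x {b} ρ → WfPat x → InWeb (pty x) b → patVal x (bind x b ρ) ≡ b
patVal-bind (pv v) ρ _ _ = ↦-same ρ v _
patVal-bind (pp p q) ρ (wf-p p-wf q-wf _ p#q) (w-⊗ b₁ b₂) =
  cong₂ ⟨_,_⟩
    (trans (patVal-cong p (λ u∈p → bind-∉ q _ _ (p#q u∈p))) (patVal-bind p ρ p-wf b₁))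
    (patVal-bind q _ q-wf b₂)

bind-typed : ∀ x {ρ b} → TypedEnv ρ → InWeb (pty x) b → TypedEnv (bind x b ρ)
bind-typed (pv v)   ρ-typed b-typed       = ↦-typed v ρ-typed b-typed
bind-typed (pp p q) ρ-typed (w-⊗ b₁ b₂) = bind-typed q (bind-typed p ρ-typed b₁) b₂

Positive : Var → Set
Positive y = isArr (ty y) ≡ false

Pos⇒¬isArr : ∀ {A} → Pos A → isArr A ≡ false
Pos⇒¬isArr pos-𝔹       = refl
Pos⇒¬isArr (pos-⊗ _ _) = refl

Pos-pvars : ∀ x {y} → Pos (pty x) → y ∈ pvars x → Positive y
Pos-pvars (pv v)   pos          (here refl) = Pos⇒¬isArr pos
Pos-pvars (pp p q) (pos-⊗ P Q) y∈ with ∈-++⁻ (pvars p) y∈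
... | inj₁ y∈p = Pos-pvars p P y∈p
... | inj₂ y∈q = Pos-pvars q Q y∈q

Positive⇒≢ : ∀ {y f} → Positive y → isArr (ty f) ≡ true → y ≢ f
Positive⇒≢ y-pos f-arrow refl with () ← trans (sym y-pos) f-arrow

arrowVar-nothing : ∀ x → (∀ {y} → y ∈ pvars x → Positive y) → arrowVar x ≡ nothing
arrowVar-nothing (pv v) pos rewrite pos (here refl) = refl
arrowVar-nothing (pp p q) pos
  rewrite arrowVar-nothing p (pos ∘ ∈-++⁺ˡ) | arrowVar-nothing q (pos ∘ ∈-++⁺ʳ (pvars p)) = refl

arrowVar-just⁻ : ∀ v {f} → arrowVar v ≡ just f → f ∈ pvars v × isArr (ty f) ≡ true
arrowVar-just⁻ (pv v) eq with isArr (ty v) in v-arrow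
arrowVar-just⁻ (pv v) refl | true = here refl , v-arrow
arrowVar-just⁻ (pp p q) eq with arrowVar p in p-arrow
arrowVar-just⁻ (pp p q) refl | just _ = Data.Product.map₁ ∈-++⁺ˡ (arrowVar-just⁻ p p-arrow)
arrowVar-just⁻ (pp p q) eq   | nothing = Data.Product.map₁ (∈-++⁺ʳ (pvars p)) (arrowVar-just⁻ q eq)

arrowVar-unique : ∀ v {f y} → WfPat v → arrowVar v ≡ just f → y ∈ pvars v → isArr (ty y) ≡ true → y ≡ f
arrowVar-unique (pv v) _ eq (here refl) y-arrow rewrite y-arrow with eq
... | refl = refl
arrowVar-unique (pp p q) (wf-p _ q-wf P _) eq y∈ y-arrow with ∈-++⁻ (pvars p) y∈
... | inj₁ y∈p with () ← trans (sym (Pos-pvars p P y∈p)) y-arrow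
... | inj₂ y∈q rewrite arrowVar-nothing p (Pos-pvars p P) = arrowVar-unique q q-wf eq y∈q y-arrow

arrowVar-other : ∀ v {f y} → WfPat v → arrowVar v ≡ just f → y ∈ pvars v → y ≢ f → Positive y
arrowVar-other v {y = y} v-wf eq y∈ y≢f with isArr (ty y) in y-arrow
... | true  = ⊥-elim (y≢f (arrowVar-unique v v-wf eq y∈ y-arrow))
... | false = refl

arrowVar-pv : ∀ f {A B} → ty f ≡ A ⊸ B → arrowVar (pv f) ≡ just f
arrowVar-pv f f-type rewrite f-type = refl

posPart-Pos : ∀ x → Pos (pty x) → posPart x ≡ just x
posPart-Pos (pv v)   pos          rewrite Pos⇒¬isArr pos = refl
posPart-Pos (pp p q) (pos-⊗ P Q) rewrite posPart-Pos p P | posPart-Pos q Q = refl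

pvarsᴹ : Maybe Pat → List Var
pvarsᴹ nothing  = []
pvarsᴹ (just p) = pvars p

nonArrows : List Var → List Var
nonArrows = filter (λ y → isArr (ty y) Bool.≟ false)

pvars-posPart : ∀ v → pvarsᴹ (posPart v) ≡ nonArrows (pvars v)
pvars-posPart (pv v) with isArr (ty v)
... | true  = refl
... | false = refl
pvars-posPart (pp p q) = begin
  pvarsᴹ (posPart (pp p q))                      ≡⟨ split p q ⟩
  pvarsᴹ (posPart p) ++ pvarsᴹ (posPart q)       ≡⟨ cong₂ _++_ (pvars-posPart p) (pvars-posPart q) ⟩
  nonArrows (pvars p) ++ nonArrows (pvars q)     ≡⟨ filter-++ _ (pvars p) (pvars q) ⟨
  nonArrows (pvars p ++ pvars q)                 ∎
  where
  open ≡-Reasoning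
  split : ∀ p q → pvarsᴹ (posPart (pp p q)) ≡ pvarsᴹ (posPart p) ++ pvarsᴹ (posPart q)
  split p q with posPart p | posPart q
  ... | just _  | just _  = refl
  ... | just _  | nothing = sym (++-identityʳ _)
  ... | nothing | _       = refl

∈-posPart⁻ : ∀ v {y} → y ∈ pvarsᴹ (posPart v) → y ∈ pvars v × Positive y
∈-posPart⁻ v = ∈-filter⁻ (λ y → isArr (ty y) Bool.≟ false) ∘ subst (_ ∈_) (pvars-posPart v)

∈-posPart⁺ : ∀ v {y} → y ∈ pvars v → Positive y → y ∈ pvarsᴹ (posPart v)
∈-posPart⁺ v y∈ pos =
  subst (_ ∈_) (sym (pvars-posPart v)) (∈-filter⁺ (λ y → isArr (ty y) Bool.≟ false) y∈ pos)

summedArrow : Pat → Maybe Var → Maybe Var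
summedArrow w nothing = nothing
summedArrow w (just f) with f ∈? pvars w
... | yes _ = nothing
... | no _  = just f

summedArrow-just⁻ : ∀ w m {g} → summedArrow w m ≡ just g → m ≡ just g
summedArrow-just⁻ w (just f) eq with f ∈? pvars w
summedArrow-just⁻ w (just f) refl | no _ = refl

summedArrow-∉ : ∀ w {f} → f ∉ pvars w → summedArrow w (just f) ≡ just f
summedArrow-∉ w {f} f∉w with f ∈? pvars w
... | yes f∈w = ⊥-elim (f∉w f∈w)
... | no _    = refl

summedArrow-∈ : ∀ w v {g} → summedArrow w (arrowVar v) ≡ just g → g ∈ pvars v
summedArrow-∈ w v eq = proj₁ (arrowVar-just⁻ v (summedArrow-just⁻ w (arrowVar v) eq))

module _ {c ℓ} (R : CommutativeSemiring c ℓ) where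

  open Lang R
  open CommutativeSemiring R renaming (Carrier to C; refl to ≈-refl; sym to ≈-sym; trans to ≈-trans)
  open CommutativeSemigroupProperties +-commutativeSemigroup
    using () renaming (interchange to +-interchange)
  module * = CommutativeSemigroupProperties *-commutativeSemigroup

  -- Finite sums and the semantics

  ∑ : {A : Set} → List A → (A → C) → C
  ∑ xs F = sumC (map F xs)

  module _ {A : Set} where

    ∑-cong : ∀ (xs : List A) {F G : A → C} → (∀ {x} → x ∈ xs → F x ≈ G x) → ∑ xs F ≈ ∑ xs G
    ∑-cong []       F≈G = ≈-refl
    ∑-cong (x ∷ xs) F≈G = +-cong (F≈G (here refl)) (∑-cong xs (F≈G ∘ there))

    ∑-cong-≡ : ∀ (xs : List A) {F G : A → C} → (∀ {x} → x ∈ xs → F x ≡ G x) → ∑ xs F ≡ ∑ xs G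
    ∑-cong-≡ xs F≡G = cong sumC (map-cong-local (All.tabulate F≡G))

    ∑-++ : ∀ (xs ys : List A) (F : A → C) → ∑ (xs ++ ys) F ≈ ∑ xs F + ∑ ys F
    ∑-++ []       ys F = ≈-sym (+-identityˡ _)
    ∑-++ (x ∷ xs) ys F = ≈-trans (+-congˡ (∑-++ xs ys F)) (≈-sym (+-assoc _ _ _))

    ∑-*ˡ : ∀ (xs : List A) a (F : A → C) → a * ∑ xs F ≈ ∑ xs (λ x → a * F x)
    ∑-*ˡ []       a F = zeroʳ a
    ∑-*ˡ (x ∷ xs) a F = ≈-trans (distribˡ a _ _) (+-congˡ (∑-*ˡ xs a F))

    ∑-0 : ∀ (xs : List A) → ∑ xs (λ _ → 0#) ≈ 0#
    ∑-0 []       = ≈-refl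
    ∑-0 (x ∷ xs) = ≈-trans (+-identityˡ _) (∑-0 xs)

    ∑-+ : ∀ (xs : List A) (F G : A → C) → ∑ xs (λ x → F x + G x) ≈ ∑ xs F + ∑ xs G
    ∑-+ []       F G = ≈-sym (+-identityˡ 0#)
    ∑-+ (x ∷ xs) F G = ≈-trans (+-congˡ (∑-+ xs F G)) (+-interchange _ _ _ _)

  ∑-comm : ∀ {A B : Set} (xs : List A) (ys : List B) (F : A → B → C) →
           ∑ xs (λ x → ∑ ys (F x)) ≈ ∑ ys (λ y → ∑ xs (λ x → F x y))
  ∑-comm []       ys F = ≈-sym (∑-0 ys)
  ∑-comm (x ∷ xs) ys F = ≈-trans (+-congˡ (∑-comm xs ys F)) (≈-sym (∑-+ ys (F x) _))

  ∑-map : ∀ {A B : Set} (xs : List A) (g : A → B) (F : B → C) → ∑ (map g xs) F ≡ ∑ xs (F ∘ g)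
  ∑-map []       g F = refl
  ∑-map (x ∷ xs) g F = cong (F (g x) +_) (∑-map xs g F)

  ∑-cartesianProductWith : ∀ {A B D : Set} (g : A → B → D) xs ys (F : D → C) →
    ∑ (cartesianProductWith g xs ys) F ≈ ∑ xs (λ x → ∑ ys (λ y → F (g x y)))
  ∑-cartesianProductWith g []       ys F = ≈-refl
  ∑-cartesianProductWith g (x ∷ xs) ys F =
    ≈-trans (∑-++ (map (g x) ys) _ F)
            (+-cong (reflexive (∑-map ys (g x) F)) (∑-cartesianProductWith g xs ys F))

  δ-pair : ∀ a b c d → δ ⟨ a , b ⟩ ⟨ c , d ⟩ ≈ δ a c * δ b d
  δ-pair a b c d with a ≟Val c | b ≟Val d
  ... | yes refl | yes refl = ≈-sym (*-identityˡ 1#)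
  ... | no _     | _        = ≈-sym (zeroˡ _)
  ... | yes refl | no _     = ≈-sym (zeroʳ _)

  mutual
    ∑-δ : ∀ A {c} → InWeb A c → ∀ H → ∑ (elems A) (λ u → δ u c * H u) ≈ H c
    ∑-δ 𝔹 w-t H = begin
      δ vt vt * H vt + (δ vf vt * H vf + 0#) ≈⟨ +-cong (*-identityˡ _) (+-congʳ (zeroˡ _)) ⟩
      H vt + (0# + 0#)                       ≈⟨ +-congˡ (+-identityˡ _) ⟩
      H vt + 0#                              ≈⟨ +-identityʳ _ ⟩
      H vt                                   ∎
      where open SetoidReasoning setoid
    ∑-δ 𝔹 w-f H = begin
      δ vt vf * H vt + (δ vf vf * H vf + 0#) ≈⟨ +-cong (zeroˡ _) (+-congʳ (*-identityˡ _)) ⟩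
      0# + (H vf + 0#)                       ≈⟨ +-identityˡ _ ⟩
      H vf + 0#                              ≈⟨ +-identityʳ _ ⟩
      H vf                                   ∎
      where open SetoidReasoning setoid
    ∑-δ (A ⊗ B) (w-⊗ a b) H = ∑-δ-pairs A B a b H
    ∑-δ (A ⊸ B) (w-⊸ a b) H = ∑-δ-pairs A B a b H

    ∑-δ-pairs : ∀ A B {a b} → InWeb A a → InWeb B b → ∀ H →
      ∑ (cartesianProductWith ⟨_,_⟩ (elems A) (elems B)) (λ u → δ u ⟨ a , b ⟩ * H u) ≈ H ⟨ a , b ⟩
    ∑-δ-pairs A B {a} {b} a-typed b-typed H = begin
      ∑ (cartesianProductWith ⟨_,_⟩ (elems A) (elems B)) (λ u → δ u ⟨ a , b ⟩ * H u)
        ≈⟨ ∑-cartesianProductWith ⟨_,_⟩ (elems A) (elems B) _ ⟩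
      ∑ (elems A) (λ x → ∑ (elems B) (λ y → δ ⟨ x , y ⟩ ⟨ a , b ⟩ * H ⟨ x , y ⟩))
        ≈⟨ ∑-cong (elems A) (λ {x} _ →
             ≈-trans (∑-cong (elems B) (λ _ → split x _)) (≈-sym (∑-*ˡ (elems B) (δ x a) _))) ⟩
      ∑ (elems A) (λ x → δ x a * ∑ (elems B) (λ y → δ y b * H ⟨ x , y ⟩))
        ≈⟨ ∑-δ A a-typed (λ x → ∑ (elems B) (λ y → δ y b * H ⟨ x , y ⟩)) ⟩
      ∑ (elems B) (λ y → δ y b * H ⟨ a , y ⟩)
        ≈⟨ ∑-δ B b-typed (λ y → H ⟨ a , y ⟩) ⟩
      H ⟨ a , b ⟩ ∎
      where
      open SetoidReasoning setoid
      split : ∀ x y → δ ⟨ x , y ⟩ ⟨ a , b ⟩ * H ⟨ x , y ⟩ ≈ δ x a * (δ y b * H ⟨ x , y ⟩)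
      split x y = ≈-trans (*-congʳ (δ-pair x y a b)) (*-assoc _ _ _)

  ⟦⟧-local : ∀ {e T} → e ∶ T → ∀ {b} → InWeb T b →
             ∀ {ρ ρ'} → Agree (FV e) ρ ρ' → ⟦ e ⟧ ρ b ≡ ⟦ e ⟧ ρ' b
  ⟦⟧-local (t-var _)              {b} _ ag = cong (λ a → δ a b) (ag (here refl))
  ⟦⟧-local (t-cst {M} {x} _ _)    {b} _ ag = cong (λ a → Const.mat M a b) (patVal-cong x ag)
  ⟦⟧-local t-cst₀                     _ ag = refl
  ⟦⟧-local (t-app {f} {x} _ _ _ _) {b} _ ag =
    cong₂ (λ a a' → appSem a a' b) (ag (here refl)) (patVal-cong x (ag ∘ there))
  ⟦⟧-local (t-pair {e} te _ te' _) (w-⊗ b₁ b₂) ag =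
    cong₂ _*_ (⟦⟧-local te b₁ (ag ∘ ∈-++⁺ˡ)) (⟦⟧-local te' b₂ (ag ∘ ∈-++⁺ʳ (FV e)))
  ⟦⟧-local (t-lam {x} _ _ te) (w-⊸ b₁ b₂) ag = ⟦⟧-local te b₂ (bind-agree x b₁ ag)
  ⟦⟧-local (t-let {v} {e} _ te te' _ _) b-typed ag = ∑-cong-≡ (elems (pty v)) λ w∈ →
    cong₂ _*_ (⟦⟧-local te (∈-elems⁻ _ w∈) (ag ∘ ∈-++⁺ˡ))
              (⟦⟧-local te' b-typed (bind-agree v (∈-elems⁻ _ w∈) (ag ∘ ∈-++⁺ʳ (FV e))))

  -- Factors

  open Factor

  infix 4 _≐_
  _≐_ : List Var → List Var → Set
  xs ≐ ys = ∀ v → (v ∈ xs → v ∈ ys) × (v ∈ ys → v ∈ xs)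

  ⊆⊇⇒≐ : ∀ {xs ys} → xs ⊆ ys → ys ⊆ xs → xs ≐ ys
  ⊆⊇⇒≐ xs⊆ys ys⊆xs v = xs⊆ys , ys⊆xs

  ≐⇒⊆ : ∀ {xs ys} → xs ≐ ys → xs ⊆ ys
  ≐⇒⊆ xs≐ys {v} = proj₁ (xs≐ys v)

  ≐⇒⊇ : ∀ {xs ys} → xs ≐ ys → ys ⊆ xs
  ≐⇒⊇ xs≐ys {v} = proj₂ (xs≐ys v)

  ↭⇒≐ : ∀ {xs ys} → xs ↭ₚ ys → xs ≐ ys
  ↭⇒≐ xs↭ys = ⊆⊇⇒≐ (∈-resp-↭ₚ xs↭ys) (∈-resp-↭ₚ (↭ₚ-sym xs↭ys))

  ≈F-refl : ∀ {φ} → φ ≈F φ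
  ≈F-refl = (λ v → id , id) , (λ ρ _ → ≈-refl)

  ≈F-sym : ∀ {φ ψ} → φ ≈F ψ → ψ ≈F φ
  ≈F-sym (vs , fs) = (λ v → proj₂ (vs v) , proj₁ (vs v)) , (λ ρ t → ≈-sym (fs ρ t))

  ≈F-trans : ∀ {φ ψ χ} → φ ≈F ψ → ψ ≈F χ → φ ≈F χ
  ≈F-trans (vs , fs) (vs' , fs') =
    ⊆⊇⇒≐ (≐⇒⊆ vs' ∘ ≐⇒⊆ vs) (≐⇒⊇ vs ∘ ≐⇒⊇ vs') , (λ ρ t → ≈-trans (fs ρ t) (fs' ρ t))

  ≈F-isEquivalence : IsEquivalence _≈F_
  ≈F-isEquivalence = record { refl = ≈F-refl ; sym = ≈F-sym ; trans = ≈F-trans }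

  Factor-setoid : Setoid c ℓ
  Factor-setoid = record { isEquivalence = ≈F-isEquivalence }

  unitF : Factor
  unitF = ⨀ []

  ⊙-cong : ∀ {φ φ' ψ ψ'} → φ ≈F φ' → ψ ≈F ψ' → (φ ⊙ ψ) ≈F (φ' ⊙ ψ')
  ⊙-cong (vs , fs) (vs' , fs') =
    ⊆⊇⇒≐ (++⁺ (≐⇒⊆ vs) (≐⇒⊆ vs')) (++⁺ (≐⇒⊇ vs) (≐⇒⊇ vs')) , (λ ρ t → *-cong (fs ρ t) (fs' ρ t))

  ⊙-comm : ∀ φ ψ → (φ ⊙ ψ) ≈F (ψ ⊙ φ)
  ⊙-comm φ ψ = ↭⇒≐ (↭ₚ-++-comm (fvars φ) (fvars ψ)) , (λ ρ _ → *-comm _ _)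

  ⊙-assoc : ∀ φ ψ χ → ((φ ⊙ ψ) ⊙ χ) ≈F (φ ⊙ (ψ ⊙ χ))
  ⊙-assoc φ ψ χ = ↭⇒≐ (↭ₚ-reflexive (++-assoc (fvars φ) (fvars ψ) (fvars χ))) , (λ ρ _ → *-assoc _ _ _)

  ⊙-identityˡ : ∀ φ → (unitF ⊙ φ) ≈F φ
  ⊙-identityˡ φ = (λ v → id , id) , (λ ρ _ → *-identityˡ _)

  ⊙-identityʳ : ∀ φ → (φ ⊙ unitF) ≈F φ
  ⊙-identityʳ φ = ↭⇒≐ (↭ₚ-reflexive (++-identityʳ (fvars φ))) , (λ ρ _ → *-identityʳ _)

  ⊙-commutativeMonoid : CommutativeMonoid c ℓ
  ⊙-commutativeMonoid = record
    { _≈_ = _≈F_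
    ; _∙_ = _⊙_
    ; ε   = unitF
    ; isCommutativeMonoid = record
      { isMonoid = record
        { isSemigroup = record
          { isMagma = record { isEquivalence = ≈F-isEquivalence ; ∙-cong = ⊙-cong }
          ; assoc = ⊙-assoc }
        ; identity = ⊙-identityˡ , ⊙-identityʳ }
      ; comm = ⊙-comm } }

  -- Factors are functions on whole environments; Σ[_]_ and _⊙_ behave as in the paper only on
  -- factors that read nothing but their declared variables.
  Local : Factor → Set ℓ
  Local φ = ∀ ρ ρ' → TypedEnv ρ → TypedEnv ρ' → Agree (fvars φ) ρ ρ' → fn φ ρ ≈ fn φ ρ'

  Local-⊙ : ∀ {φ ψ} → Local φ → Local ψ → Local (φ ⊙ ψ)
  Local-⊙ {φ} φ-local ψ-local ρ ρ' t t' ag =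
    *-cong (φ-local ρ ρ' t t' (ag ∘ ∈-++⁺ˡ)) (ψ-local ρ ρ' t t' (ag ∘ ∈-++⁺ʳ (fvars φ)))

  Local-⨀ : ∀ {Γ} → All Local Γ → Local (⨀ Γ)
  Local-⨀ []                  _ _ _ _ _ = ≈-refl
  Local-⨀ (φ-local ∷ Γ-local) = Local-⊙ φ-local (Local-⨀ Γ-local)

  Local-Σ : ∀ g {φ} → Local φ → Local (Σ[ g ] φ)
  Local-Σ g {φ} φ-local ρ ρ' t t' ag with g ∈? fvars φ
  ... | yes _   = ∑-cong (elems (ty g)) λ {w} w∈ →
    φ-local _ _ (↦-typed g t (∈-elems⁻ _ w∈)) (↦-typed g t' (∈-elems⁻ _ w∈)) (↦-agree (fvars φ) g w ag)
  ... | no g∉φ  = φ-local ρ ρ' t t' λ u∈ →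
    ag (∈-∖⁺ u∈ λ u∈[g] → g∉φ (subst (_∈ fvars φ) (singleton⁻ u∈[g]) u∈))

  Local-Fact : ∀ v e → e ∶ pty v → Local (Fact v e)
  Local-Fact v e e-typed ρ ρ' t t' ag = reflexive (trans
    (cong (⟦ e ⟧ ρ) (patVal-cong v (ag ∘ ∈-++⁺ʳ (FV e))))
    (⟦⟧-local e-typed (patVal-typed v t') (ag ∘ ∈-++⁺ˡ)))

  Local-Fact-app : ∀ v f x → Local (Fact v (app f x))
  Local-Fact-app v f x ρ ρ' _ _ ag = reflexive (trans
    (cong₂ (λ a b → appSem a b (patVal v ρ)) (ag (here refl)) (patVal-cong x (ag ∘ ∈-++⁺ˡ ∘ there)))
    (cong (appSem (ρ' f) (patVal x ρ')) (patVal-cong v (ag ∘ ∈-++⁺ʳ (f ∷ pvars x)))))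

  Σ-cong : ∀ g {φ ψ} → φ ≈F ψ → (Σ[ g ] φ) ≈F (Σ[ g ] ψ)
  Σ-cong g {φ} {ψ} (vs , fs) = ⊆⊇⇒≐ (∖-mono (g ∷ []) (≐⇒⊆ vs)) (∖-mono (g ∷ []) (≐⇒⊇ vs)) , values
    where
    values : ∀ ρ → TypedEnv ρ → fn (Σ[ g ] φ) ρ ≈ fn (Σ[ g ] ψ) ρ
    values ρ t with g ∈? fvars φ | g ∈? fvars ψ
    ... | yes _    | yes _    = ∑-cong (elems (ty g)) λ w∈ → fs _ (↦-typed g t (∈-elems⁻ _ w∈))
    ... | yes g∈φ  | no g∉ψ   = ⊥-elim (g∉ψ (≐⇒⊆ vs g∈φ))
    ... | no g∉φ   | yes g∈ψ  = ⊥-elim (g∉φ (≐⇒⊇ vs g∈ψ))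
    ... | no _     | no _     = fs ρ t

  Σ-pull : ∀ g φ ψ → Local φ → g ∉ fvars φ → (Σ[ g ] (φ ⊙ ψ)) ≈F (φ ⊙ (Σ[ g ] ψ))
  Σ-pull g φ ψ φ-local g∉φ = ⊆⊇⇒≐ to from , values
    where
    to : (fvars φ ++ fvars ψ) ∖ (g ∷ []) ⊆ fvars φ ++ (fvars ψ ∖ (g ∷ []))
    to u∈ with ∈-∖⁻ u∈
    ... | u∈φψ , u≢g with ∈-++⁻ (fvars φ) u∈φψ
    ...   | inj₁ u∈φ = ∈-++⁺ˡ u∈φ
    ...   | inj₂ u∈ψ = ∈-++⁺ʳ (fvars φ) (∈-∖⁺ u∈ψ u≢g)
    from : fvars φ ++ (fvars ψ ∖ (g ∷ [])) ⊆ (fvars φ ++ fvars ψ) ∖ (g ∷ [])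
    from u∈ with ∈-++⁻ (fvars φ) u∈
    ... | inj₁ u∈φ =
      ∈-∖⁺ (∈-++⁺ˡ u∈φ) λ u∈[g] → g∉φ (subst (_∈ fvars φ) (singleton⁻ u∈[g]) u∈φ)
    ... | inj₂ u∈ψ∖g = let u∈ψ , u≢g = ∈-∖⁻ u∈ψ∖g in ∈-∖⁺ (∈-++⁺ʳ (fvars φ) u∈ψ) u≢g
    values : ∀ ρ → TypedEnv ρ → fn (Σ[ g ] (φ ⊙ ψ)) ρ ≈ fn (φ ⊙ (Σ[ g ] ψ)) ρ
    values ρ t with g ∈? (fvars φ ++ fvars ψ) | g ∈? fvars ψ
    ... | yes _ | yes _ = ≈-trans
      (∑-cong (elems (ty g)) λ {w} w∈ →
        *-congʳ (φ-local _ _ (↦-typed g t (∈-elems⁻ _ w∈)) t (↦-agree-∉ (fvars φ) g w ρ g∉φ)))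
      (≈-sym (∑-*ˡ (elems (ty g)) _ _))
    ... | yes g∈φψ | no g∉ψ = ⊥-elim ([ g∉φ , g∉ψ ] (∈-++⁻ (fvars φ) g∈φψ))
    ... | no g∉φψ  | yes g∈ψ = ⊥-elim (g∉φψ (∈-++⁺ʳ (fvars φ) g∈ψ))
    ... | no _     | no _    = ≈-refl

  Σ-comm : ∀ g h φ → g ≢ h → Local φ → (Σ[ g ] (Σ[ h ] φ)) ≈F (Σ[ h ] (Σ[ g ] φ))
  Σ-comm g h φ g≢h φ-local = ⊆⊇⇒≐ ∖∖-comm ∖∖-comm , values
    where
    ∖∖-comm : ∀ {g h} → (fvars φ ∖ (h ∷ [])) ∖ (g ∷ []) ⊆ (fvars φ ∖ (g ∷ [])) ∖ (h ∷ [])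
    ∖∖-comm {g} {h} u∈ =
      let u∈φ∖h , u≢g = ∈-∖⁻ {xs = fvars φ ∖ (h ∷ [])} u∈
          u∈φ , u≢h   = ∈-∖⁻ {xs = fvars φ} u∈φ∖h
      in ∈-∖⁺ (∈-∖⁺ {ys = g ∷ []} u∈φ u≢g) u≢h
    h≢g : h ≢ g
    h≢g = g≢h ∘ sym
    double : ∀ ρ → TypedEnv ρ →
      ∑ (elems (ty g)) (λ a → ∑ (elems (ty h)) (λ b → fn φ ((ρ [ g ↦ a ]) [ h ↦ b ])))
      ≈ ∑ (elems (ty h)) (λ b → ∑ (elems (ty g)) (λ a → fn φ ((ρ [ h ↦ b ]) [ g ↦ a ])))
    double ρ t = ≈-trans (∑-comm (elems (ty g)) (elems (ty h)) _)
      (∑-cong (elems (ty h)) λ b∈ → ∑-cong (elems (ty g)) λ a∈ →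
        φ-local _ _ (↦-typed h (↦-typed g t (∈-elems⁻ _ a∈)) (∈-elems⁻ _ b∈))
                    (↦-typed g (↦-typed h t (∈-elems⁻ _ b∈)) (∈-elems⁻ _ a∈))
                    (λ {u} _ → ↦-comm ρ _ _ g≢h u))
    values : ∀ ρ → TypedEnv ρ → fn (Σ[ g ] (Σ[ h ] φ)) ρ ≈ fn (Σ[ h ] (Σ[ g ] φ)) ρ
    values ρ t with g ∈? fvars φ | h ∈? fvars φ
    ... | yes g∈ | yes h∈
      rewrite dec-true (g ∈? (fvars φ ∖ (h ∷ []))) (∈-∖⁺ g∈ (∉-singleton g≢h))
            | dec-true (h ∈? (fvars φ ∖ (g ∷ []))) (∈-∖⁺ h∈ (∉-singleton h≢g)) = double ρ t
    ... | yes g∈ | no h∉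
      rewrite dec-true (g ∈? (fvars φ ∖ (h ∷ []))) (∈-∖⁺ g∈ (∉-singleton g≢h))
            | dec-false (h ∈? (fvars φ ∖ (g ∷ []))) (h∉ ∘ proj₁ ∘ ∈-∖⁻) = ≈-refl
    ... | no g∉ | yes h∈
      rewrite dec-false (g ∈? (fvars φ ∖ (h ∷ []))) (g∉ ∘ proj₁ ∘ ∈-∖⁻)
            | dec-true (h ∈? (fvars φ ∖ (g ∷ []))) (∈-∖⁺ h∈ (∉-singleton h≢g)) = ≈-refl
    ... | no g∉ | no h∉
      rewrite dec-false (g ∈? (fvars φ ∖ (h ∷ []))) (g∉ ∘ proj₁ ∘ ∈-∖⁻)
            | dec-false (h ∈? (fvars φ ∖ (g ∷ []))) (h∉ ∘ proj₁ ∘ ∈-∖⁻) = ≈-refl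

  open PermutationSetoid Factor-setoid
    using (_↭_; prep; ↭-refl; ↭-sym; ↭-trans; ↭-prep; ↭-swap; ↭-reflexive; module PermutationReasoning)
  module ↭ = PermutationSetoidProperties Factor-setoid

  module ⊙ = CommutativeSemigroupProperties (CommutativeMonoid.commutativeSemigroup ⊙-commutativeMonoid)

  ⨀-resp-↭ : ∀ {Γ Δ} → Γ ↭ Δ → ⨀ Γ ≈F ⨀ Δ
  ⨀-resp-↭ = ↭.foldr-commMonoid (CommutativeMonoid.isCommutativeMonoid ⊙-commutativeMonoid)

  ⨀-++ : ∀ Γ Δ → ⨀ (Γ ++ Δ) ≈F (⨀ Γ ⊙ ⨀ Δ)
  ⨀-++ []      Δ = ≈F-sym (⊙-identityˡ (⨀ Δ))
  ⨀-++ (φ ∷ Γ) Δ = ≈F-trans (⊙-cong (≈F-refl {φ}) (⨀-++ Γ Δ)) (≈F-sym (⊙-assoc φ (⨀ Γ) (⨀ Δ)))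

  ∈-fvars-⨀⁻ : ∀ Γ {v} → v ∈ fvars (⨀ Γ) → Any (λ φ → v ∈ fvars φ) Γ
  ∈-fvars-⨀⁻ (φ ∷ Γ) v∈ with ∈-++⁻ (fvars φ) v∈
  ... | inj₁ v∈φ = here v∈φ
  ... | inj₂ v∈Γ = there (∈-fvars-⨀⁻ Γ v∈Γ)

  ∈-fvars-⨀⁺ : ∀ Γ {v φ} → φ ∈ Γ → v ∈ fvars φ → v ∈ fvars (⨀ Γ)
  ∈-fvars-⨀⁺ (ψ ∷ Γ) (here refl) v∈φ = ∈-++⁺ˡ v∈φ
  ∈-fvars-⨀⁺ (ψ ∷ Γ) (there φ∈Γ)   v∈φ = ∈-++⁺ʳ (fvars ψ) (∈-fvars-⨀⁺ Γ φ∈Γ v∈φ)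

  ∉-fvars-⨀ : ∀ {Γ v} → All (λ φ → v ∉ fvars φ) Γ → v ∉ fvars (⨀ Γ)
  ∉-fvars-⨀ {Γ} v∉Γ v∈ = All.lookupWith id v∉Γ (∈-fvars-⨀⁻ Γ v∈)

  module _ (g : Var) where

    mentions-none : ∀ {Γ} → All (λ φ → g ∉ fvars φ) Γ → mentions g Γ ≡ []
    mentions-none = filter-none (λ φ → g ∈? fvars φ)

    avoids-all : ∀ {Γ} → All (λ φ → g ∉ fvars φ) Γ → avoids g Γ ≡ Γ
    avoids-all = filter-all (λ φ → ¬? (g ∈? fvars φ))

    avoids-avoid : ∀ Γ → All (λ φ → g ∉ fvars φ) (avoids g Γ)
    avoids-avoid = all-filter (λ φ → ¬? (g ∈? fvars φ))

    All-mentions : ∀ {p} {Q : Factor → Set p} {Γ} → All Q Γ → All Q (mentions g Γ)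
    All-mentions = All-filter⁺ (λ φ → g ∈? fvars φ)

    All-avoids : ∀ {p} {Q : Factor → Set p} {Γ} → All Q Γ → All Q (avoids g Γ)
    All-avoids = All-filter⁺ (λ φ → ¬? (g ∈? fvars φ))

    ∈-mentions⁺ : ∀ {Γ φ} → φ ∈ Γ → g ∈ fvars φ → φ ∈ mentions g Γ
    ∈-mentions⁺ = ∈-filter⁺ (λ φ → g ∈? fvars φ)

    ∈-mentions⁻ : ∀ {Γ φ} → φ ∈ mentions g Γ → φ ∈ Γ × g ∈ fvars φ
    ∈-mentions⁻ = ∈-filter⁻ (λ φ → g ∈? fvars φ)

    mentions-↭ : ∀ {Γ Δ} → Γ ↭ Δ → mentions g Γ ↭ mentions g Δ
    mentions-↭ = ↭.filter⁺ (λ φ → g ∈? fvars φ) (λ φ≈ψ → ≐⇒⊆ (proj₁ φ≈ψ))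

    avoids-↭ : ∀ {Γ Δ} → Γ ↭ Δ → avoids g Γ ↭ avoids g Δ
    avoids-↭ = ↭.filter⁺ (λ φ → ¬? (g ∈? fvars φ)) (λ φ≈ψ g∉φ → g∉φ ∘ ≐⇒⊇ (proj₁ φ≈ψ))

    mentions++avoids : ∀ Γ → Γ ↭ mentions g Γ ++ avoids g Γ
    mentions++avoids []      = ↭-refl
    mentions++avoids (φ ∷ Γ) with g ∈? fvars φ
    ... | yes _ = ↭-prep φ (mentions++avoids Γ)
    ... | no _  = ↭-trans (↭-prep φ (mentions++avoids Γ)) (↭-sym (↭.↭-shift (mentions g Γ) (avoids g Γ)))

  -- Summing out an arrow variable

  marginalise : Var → Factor → List Factor → Factor
  marginalise g F Γ = Σ[ g ] (F ⊙ ⨀ (mentions g Γ))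

  sumOut : Var → Factor → List Factor → List Factor
  sumOut g F Γ = marginalise g F Γ ∷ avoids g Γ

  addFactor : Maybe Var → Factor → List Factor → List Factor
  addFactor nothing  F Γ = F ∷ Γ
  addFactor (just g) F Γ = sumOut g F Γ

  factsLet-addFactor : ∀ v e w Γ → factsLet v e w Γ ≡ addFactor (summedArrow w (arrowVar v)) (Fact v e) Γ
  factsLet-addFactor v e w Γ with arrowVar v
  ... | nothing = refl
  ... | just f with f ∈? pvars w
  ...   | yes _ = refl
  ...   | no _  = refl

  Local-marginalise : ∀ g {F Γ} → Local F → All Local Γ → Local (marginalise g F Γ)
  Local-marginalise g F-local Γ-local = Local-Σ g (Local-⊙ F-local (Local-⨀ (All-mentions g Γ-local)))

  Local-addFactor : ∀ m {F Γ} → Local F → All Local Γ → All Local (addFactor m F Γ)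
  Local-addFactor nothing  F-local Γ-local = F-local ∷ Γ-local
  Local-addFactor (just g) F-local Γ-local = Local-marginalise g F-local Γ-local ∷ All-avoids g Γ-local

  marginalise-cong : ∀ g {F F' Γ Δ} → F ≈F F' → Γ ↭ Δ → marginalise g F Γ ≈F marginalise g F' Δ
  marginalise-cong g F≈F' Γ↭Δ = Σ-cong g (⊙-cong F≈F' (⨀-resp-↭ (mentions-↭ g Γ↭Δ)))

  sumOut-cong : ∀ g {F F' Γ Δ} → F ≈F F' → Γ ↭ Δ → sumOut g F Γ ↭ sumOut g F' Δ
  sumOut-cong g F≈F' Γ↭Δ = prep (marginalise-cong g F≈F' Γ↭Δ) (avoids-↭ g Γ↭Δ)

  addFactor-cong : ∀ m {F F' Γ Δ} → F ≈F F' → Γ ↭ Δ → addFactor m F Γ ↭ addFactor m F' Δ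
  addFactor-cong nothing  = prep
  addFactor-cong (just g) = sumOut-cong g

  factsLet-cong : ∀ v e w {Γ Δ} → Γ ↭ Δ → factsLet v e w Γ ↭ factsLet v e w Δ
  factsLet-cong v e w {Γ} {Δ} Γ↭Δ = begin
    factsLet v e w Γ                                        ≡⟨ factsLet-addFactor v e w Γ ⟩
    addFactor (summedArrow w (arrowVar v)) (Fact v e) Γ     ↭⟨ addFactor-cong _ (≈F-refl {Fact v e}) Γ↭Δ ⟩
    addFactor (summedArrow w (arrowVar v)) (Fact v e) Δ     ≡⟨ factsLet-addFactor v e w Δ ⟨
    factsLet v e w Δ                                        ∎
    where open PermutationReasoning

  sumOut-∷-∈ : ∀ g F {φ} Γ → g ∈ fvars φ →
               sumOut g F (φ ∷ Γ) ≡ (Σ[ g ] (F ⊙ (φ ⊙ ⨀ (mentions g Γ)))) ∷ avoids g Γ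
  sumOut-∷-∈ g F {φ} Γ g∈φ with g ∈? fvars φ
  ... | yes _   = refl
  ... | no g∉φ = ⊥-elim (g∉φ g∈φ)

  sumOut-∷-∉ : ∀ g F {φ} Γ → g ∉ fvars φ → sumOut g F (φ ∷ Γ) ≡ marginalise g F Γ ∷ φ ∷ avoids g Γ
  sumOut-∷-∉ g F {φ} Γ g∉φ with g ∈? fvars φ
  ... | yes g∈φ = ⊥-elim (g∉φ g∈φ)
  ... | no _    = refl

  ∈-marginalise-sym : ∀ g₁ g₂ F₁ F₂ Γ → g₁ ∉ fvars F₂ → g₁ ≢ g₂ →
                      g₁ ∈ fvars (marginalise g₂ F₂ Γ) → g₂ ∈ fvars (marginalise g₁ F₁ Γ)
  ∈-marginalise-sym g₁ g₂ F₁ F₂ Γ g₁∉F₂ g₁≢g₂ g₁∈ with ∈-++⁻ (fvars F₂) (proj₁ (∈-∖⁻ g₁∈))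
  ... | inj₁ g₁∈F₂ = ⊥-elim (g₁∉F₂ g₁∈F₂)
  ... | inj₂ g₁∈M₂ with find (∈-fvars-⨀⁻ (mentions g₂ Γ) g₁∈M₂)
  ...   | φ , φ∈M₂ , g₁∈φ = let φ∈Γ , g₂∈φ = ∈-mentions⁻ g₂ {Γ} φ∈M₂ in
    ∈-∖⁺ (∈-++⁺ʳ (fvars F₁) (∈-fvars-⨀⁺ (mentions g₁ Γ) (∈-mentions⁺ g₁ {Γ} φ∈Γ g₁∈φ) g₂∈φ))
         (∉-singleton (g₁≢g₂ ∘ sym))

  touching : Var → Var → List Factor → List Factor
  touching g₁ g₂ Γ =
    mentions g₁ (mentions g₂ Γ) ++ (mentions g₁ (avoids g₂ Γ) ++ avoids g₁ (mentions g₂ Γ))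

  touching-comm : ∀ g₁ g₂ Γ → touching g₁ g₂ Γ ↭ touching g₂ g₁ Γ
  touching-comm g₁ g₂ Γ = begin
    mentions g₁ (mentions g₂ Γ) ++ (mentions g₁ (avoids g₂ Γ) ++ avoids g₁ (mentions g₂ Γ))
      ↭⟨ ↭.++⁺ˡ (mentions g₁ (mentions g₂ Γ)) (↭.++-comm (mentions g₁ (avoids g₂ Γ)) _) ⟩
    mentions g₁ (mentions g₂ Γ) ++ (avoids g₁ (mentions g₂ Γ) ++ mentions g₁ (avoids g₂ Γ))
      ≡⟨ cong₂ (λ B O → B ++ O) (filter-comm (λ φ → g₁ ∈? fvars φ) (λ φ → g₂ ∈? fvars φ) Γ)
               (cong₂ _++_ (filter-comm (λ φ → ¬? (g₁ ∈? fvars φ)) (λ φ → g₂ ∈? fvars φ) Γ)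
                           (filter-comm (λ φ → g₁ ∈? fvars φ) (λ φ → ¬? (g₂ ∈? fvars φ)) Γ)) ⟩
    mentions g₂ (mentions g₁ Γ) ++ (mentions g₂ (avoids g₁ Γ) ++ avoids g₂ (mentions g₁ Γ)) ∎
    where open PermutationReasoning

  avoids-comm : ∀ g₁ g₂ Γ → avoids g₁ (avoids g₂ Γ) ≡ avoids g₂ (avoids g₁ Γ)
  avoids-comm g₁ g₂ = filter-comm (λ φ → ¬? (g₁ ∈? fvars φ)) (λ φ → ¬? (g₂ ∈? fvars φ))

  Σ-marginalise : ∀ g₁ g₂ F₁ F₂ Γ → g₂ ∉ fvars F₁ → Local F₁ → All Local Γ →
    (Σ[ g₁ ] (F₁ ⊙ (marginalise g₂ F₂ Γ ⊙ ⨀ (mentions g₁ (avoids g₂ Γ)))))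
    ≈F (Σ[ g₁ ] (Σ[ g₂ ] (⨀ (F₁ ∷ F₂ ∷ touching g₁ g₂ Γ))))
  Σ-marginalise g₁ g₂ F₁ F₂ Γ g₂∉F₁ F₁-local Γ-local = Σ-cong g₁ (begin
    F₁ ⊙ ((Σ[ g₂ ] (F₂ ⊙ ⨀ M₂)) ⊙ ⨀ O₁)  ≈⟨ ⊙.x∙yz≈xz∙y F₁ _ (⨀ O₁) ⟩
    (F₁ ⊙ ⨀ O₁) ⊙ (Σ[ g₂ ] (F₂ ⊙ ⨀ M₂))  ≈⟨ Σ-pull g₂ (F₁ ⊙ ⨀ O₁) (F₂ ⊙ ⨀ M₂) local g₂∉ ⟨
    Σ[ g₂ ] ((F₁ ⊙ ⨀ O₁) ⊙ (F₂ ⊙ ⨀ M₂))  ≈⟨ Σ-cong g₂ (≈F-sym (⨀-++ (F₁ ∷ O₁) (F₂ ∷ M₂))) ⟩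
    Σ[ g₂ ] (⨀ ((F₁ ∷ O₁) ++ (F₂ ∷ M₂)))  ≈⟨ Σ-cong g₂ (⨀-resp-↭ regroup) ⟩
    Σ[ g₂ ] (⨀ (F₁ ∷ F₂ ∷ touching g₁ g₂ Γ)) ∎)
    where
    open SetoidReasoning Factor-setoid
    M₂ = mentions g₂ Γ
    O₁ = mentions g₁ (avoids g₂ Γ)
    local : Local (F₁ ⊙ ⨀ O₁)
    local = Local-⊙ F₁-local (Local-⨀ (All-mentions g₁ (All-avoids g₂ Γ-local)))
    g₂∉ : g₂ ∉ fvars (F₁ ⊙ ⨀ O₁)
    g₂∉ g₂∈ = [ g₂∉F₁ , ∉-fvars-⨀ (All-mentions g₁ (avoids-avoid g₂ Γ)) ] (∈-++⁻ (fvars F₁) g₂∈)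
    regroup : (F₁ ∷ O₁) ++ (F₂ ∷ M₂) ↭ F₁ ∷ F₂ ∷ touching g₁ g₂ Γ
    regroup = ↭-prep F₁ (↭-trans (↭.↭-shift O₁ M₂) (↭-prep F₂
      (↭-trans (↭.++⁺ˡ O₁ (mentions++avoids g₁ M₂)) (↭.shifts O₁ (mentions g₁ M₂)))))

  marginalise-avoids : ∀ g₁ g₂ F₁ F₂ Γ → g₁ ∉ fvars (marginalise g₂ F₂ Γ) → g₁ ≢ g₂ →
                       marginalise g₁ F₁ (avoids g₂ Γ) ≡ marginalise g₁ F₁ Γ
  marginalise-avoids g₁ g₂ F₁ F₂ Γ g₁∉ g₁≢g₂ = cong (λ M → Σ[ g₁ ] (F₁ ⊙ ⨀ M)) (begin
    mentions g₁ (avoids g₂ Γ)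
      ≡⟨ filter-comm (λ φ → g₁ ∈? fvars φ) (λ φ → ¬? (g₂ ∈? fvars φ)) Γ ⟩
    avoids g₂ (mentions g₁ Γ)
      ≡⟨ avoids-all g₂ mentions-avoid ⟩
    mentions g₁ Γ
      ∎)
    where
    open ≡-Reasoning
    mentions-avoid : All (λ φ → g₂ ∉ fvars φ) (mentions g₁ Γ)
    mentions-avoid = All.tabulate λ φ∈ g₂∈φ →
      let φ∈Γ , g₁∈φ = ∈-mentions⁻ g₁ {Γ} φ∈ in
      g₁∉ (∈-∖⁺ (∈-++⁺ʳ (fvars F₂) (∈-fvars-⨀⁺ (mentions g₂ Γ) (∈-mentions⁺ g₂ {Γ} φ∈Γ g₂∈φ) g₁∈φ))
                (∉-singleton g₁≢g₂))

  Local-touching : ∀ g₁ g₂ {Γ} → All Local Γ → All Local (touching g₁ g₂ Γ)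
  Local-touching g₁ g₂ Γ-local = All-++⁺ (All-mentions g₁ (All-mentions g₂ Γ-local))
    (All-++⁺ (All-mentions g₁ (All-avoids g₂ Γ-local)) (All-avoids g₁ (All-mentions g₂ Γ-local)))

  Σ-marginalise-comm : ∀ g₁ g₂ F₁ F₂ Γ → g₁ ∉ fvars F₂ → g₂ ∉ fvars F₁ → g₁ ≢ g₂ →
    Local F₁ → Local F₂ → All Local Γ →
    (Σ[ g₁ ] (F₁ ⊙ (marginalise g₂ F₂ Γ ⊙ ⨀ (mentions g₁ (avoids g₂ Γ)))))
    ≈F (Σ[ g₂ ] (F₂ ⊙ (marginalise g₁ F₁ Γ ⊙ ⨀ (mentions g₂ (avoids g₁ Γ)))))
  Σ-marginalise-comm g₁ g₂ F₁ F₂ Γ g₁∉F₂ g₂∉F₁ g₁≢g₂ F₁-local F₂-local Γ-local = begin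
      Σ[ g₁ ] (F₁ ⊙ (marginalise g₂ F₂ Γ ⊙ ⨀ (mentions g₁ (avoids g₂ Γ))))
        ≈⟨ Σ-marginalise g₁ g₂ F₁ F₂ Γ g₂∉F₁ F₁-local Γ-local ⟩
      Σ[ g₁ ] (Σ[ g₂ ] (⨀ (F₁ ∷ F₂ ∷ touching g₁ g₂ Γ)))
        ≈⟨ Σ-cong g₁ (Σ-cong g₂ (⨀-resp-↭ (↭-swap F₁ F₂ (touching-comm g₁ g₂ Γ)))) ⟩
      Σ[ g₁ ] (Σ[ g₂ ] (⨀ (F₂ ∷ F₁ ∷ touching g₂ g₁ Γ)))
        ≈⟨ Σ-comm g₁ g₂ _ g₁≢g₂ (Local-⨀ (F₂-local ∷ F₁-local ∷ Local-touching g₂ g₁ Γ-local)) ⟩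
      Σ[ g₂ ] (Σ[ g₁ ] (⨀ (F₂ ∷ F₁ ∷ touching g₂ g₁ Γ)))
        ≈⟨ Σ-marginalise g₂ g₁ F₂ F₁ Γ g₁∉F₂ F₂-local Γ-local ⟨
      Σ[ g₂ ] (F₂ ⊙ (marginalise g₁ F₁ Γ ⊙ ⨀ (mentions g₂ (avoids g₁ Γ)))) ∎
    where open SetoidReasoning Factor-setoid

  sumOut-comm-linked : ∀ g₁ g₂ F₁ F₂ Γ → g₁ ∉ fvars F₂ → g₂ ∉ fvars F₁ → g₁ ≢ g₂ →
    Local F₁ → Local F₂ → All Local Γ → g₁ ∈ fvars (marginalise g₂ F₂ Γ) →
    sumOut g₁ F₁ (sumOut g₂ F₂ Γ) ↭ sumOut g₂ F₂ (sumOut g₁ F₁ Γ)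
  sumOut-comm-linked g₁ g₂ F₁ F₂ Γ g₁∉F₂ g₂∉F₁ g₁≢g₂ F₁-local F₂-local Γ-local g₁∈T₂ =
    begin
    sumOut g₁ F₁ (sumOut g₂ F₂ Γ)
      ≡⟨ sumOut-∷-∈ g₁ F₁ (avoids g₂ Γ) g₁∈T₂ ⟩
    (Σ[ g₁ ] (F₁ ⊙ (marginalise g₂ F₂ Γ ⊙ ⨀ (mentions g₁ (avoids g₂ Γ))))) ∷ avoids g₁ (avoids g₂ Γ)
      ↭⟨ prep (Σ-marginalise-comm g₁ g₂ F₁ F₂ Γ g₁∉F₂ g₂∉F₁ g₁≢g₂ F₁-local F₂-local Γ-local)
              (↭-reflexive (avoids-comm g₁ g₂ Γ)) ⟩
    (Σ[ g₂ ] (F₂ ⊙ (marginalise g₁ F₁ Γ ⊙ ⨀ (mentions g₂ (avoids g₁ Γ))))) ∷ avoids g₂ (avoids g₁ Γ)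
      ≡⟨ sumOut-∷-∈ g₂ F₂ (avoids g₁ Γ)
           (∈-marginalise-sym g₁ g₂ F₁ F₂ Γ g₁∉F₂ g₁≢g₂ g₁∈T₂) ⟨
    sumOut g₂ F₂ (sumOut g₁ F₁ Γ) ∎
    where open PermutationReasoning

  sumOut-comm-unlinked : ∀ g₁ g₂ F₁ F₂ Γ → g₂ ∉ fvars F₁ → g₁ ≢ g₂ →
    g₁ ∉ fvars (marginalise g₂ F₂ Γ) →
    sumOut g₁ F₁ (sumOut g₂ F₂ Γ) ↭ sumOut g₂ F₂ (sumOut g₁ F₁ Γ)
  sumOut-comm-unlinked g₁ g₂ F₁ F₂ Γ g₂∉F₁ g₁≢g₂ g₁∉T₂ = begin
    sumOut g₁ F₁ (sumOut g₂ F₂ Γ)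
      ≡⟨ sumOut-∷-∉ g₁ F₁ (avoids g₂ Γ) g₁∉T₂ ⟩
    marginalise g₁ F₁ (avoids g₂ Γ) ∷ T₂ ∷ avoids g₁ (avoids g₂ Γ)
      ≡⟨ cong (λ T → T ∷ T₂ ∷ avoids g₁ (avoids g₂ Γ))
              (marginalise-avoids g₁ g₂ F₁ F₂ Γ g₁∉T₂ g₁≢g₂) ⟩
    T₁ ∷ T₂ ∷ avoids g₁ (avoids g₂ Γ)
      ↭⟨ ↭-swap T₁ T₂ (↭-reflexive (avoids-comm g₁ g₂ Γ)) ⟩
    T₂ ∷ T₁ ∷ avoids g₂ (avoids g₁ Γ)
      ≡⟨ cong (λ T → T ∷ T₁ ∷ avoids g₂ (avoids g₁ Γ))
              (marginalise-avoids g₂ g₁ F₂ F₁ Γ g₂∉T₁ g₂≢g₁) ⟨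
    marginalise g₂ F₂ (avoids g₁ Γ) ∷ T₁ ∷ avoids g₂ (avoids g₁ Γ)
      ≡⟨ sumOut-∷-∉ g₂ F₂ (avoids g₁ Γ) g₂∉T₁ ⟨
    sumOut g₂ F₂ (sumOut g₁ F₁ Γ) ∎
    where
    open PermutationReasoning
    T₁ = marginalise g₁ F₁ Γ
    T₂ = marginalise g₂ F₂ Γ
    g₂≢g₁ : g₂ ≢ g₁
    g₂≢g₁ = g₁≢g₂ ∘ sym
    g₂∉T₁ : g₂ ∉ fvars T₁
    g₂∉T₁ = g₁∉T₂ ∘ ∈-marginalise-sym g₂ g₁ F₂ F₁ Γ g₂∉F₁ g₂≢g₁

  sumOut-comm : ∀ g₁ g₂ F₁ F₂ Γ → g₁ ∉ fvars F₂ → g₂ ∉ fvars F₁ → g₁ ≢ g₂ →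
                Local F₁ → Local F₂ → All Local Γ →
                sumOut g₁ F₁ (sumOut g₂ F₂ Γ) ↭ sumOut g₂ F₂ (sumOut g₁ F₁ Γ)
  sumOut-comm g₁ g₂ F₁ F₂ Γ g₁∉F₂ g₂∉F₁ g₁≢g₂ F₁-local F₂-local Γ-local =
    case g₁ ∈? fvars (marginalise g₂ F₂ Γ) of λ where
      (yes g₁∈T₂) →
        sumOut-comm-linked g₁ g₂ F₁ F₂ Γ g₁∉F₂ g₂∉F₁ g₁≢g₂ F₁-local F₂-local Γ-local g₁∈T₂
      (no g₁∉T₂)  → sumOut-comm-unlinked g₁ g₂ F₁ F₂ Γ g₂∉F₁ g₁≢g₂ g₁∉T₂

  addFactor-comm : ∀ m₁ m₂ F₁ F₂ Γ →
    (∀ {g} → m₁ ≡ just g → g ∉ fvars F₂) → (∀ {g} → m₂ ≡ just g → g ∉ fvars F₁) →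
    (∀ {g} → m₁ ≡ just g → m₂ ≢ just g) → Local F₁ → Local F₂ → All Local Γ →
    addFactor m₂ F₂ (addFactor m₁ F₁ Γ) ↭ addFactor m₁ F₁ (addFactor m₂ F₂ Γ)
  addFactor-comm nothing nothing F₁ F₂ Γ _ _ _ _ _ _ = ↭-swap F₂ F₁ ↭-refl
  addFactor-comm (just g) nothing F₁ F₂ Γ g∉F₂ _ _ _ _ _ =
    ↭-trans (↭-swap F₂ (marginalise g F₁ Γ) ↭-refl)
            (↭-reflexive (sym (sumOut-∷-∉ g F₁ Γ (g∉F₂ refl))))
  addFactor-comm nothing (just h) F₁ F₂ Γ _ h∉F₁ _ _ _ _ =
    ↭-trans (↭-reflexive (sumOut-∷-∉ h F₂ Γ (h∉F₁ refl))) (↭-swap (marginalise h F₂ Γ) F₁ ↭-refl)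
  addFactor-comm (just g) (just h) F₁ F₂ Γ g∉F₂ h∉F₁ g≢h F₁-local F₂-local Γ-local =
    sumOut-comm h g F₂ F₁ Γ (h∉F₁ refl) (g∉F₂ refl) (λ h≡g → g≢h refl (cong just h≡g))
                F₂-local F₁-local Γ-local

  Σ-exchange : ∀ f g Λ Ψ X → f ≢ g → g ∉ fvars Λ → f ∉ fvars X → Local Λ → Local Ψ → Local X →
               (Σ[ f ] (Λ ⊙ (Σ[ g ] (Ψ ⊙ X)))) ≈F (Σ[ g ] ((Σ[ f ] (Λ ⊙ Ψ)) ⊙ X))
  Σ-exchange f g Λ Ψ X f≢g g∉Λ f∉X Λ-local Ψ-local X-local = begin
    Σ[ f ] (Λ ⊙ (Σ[ g ] (Ψ ⊙ X)))   ≈⟨ Σ-cong f (Σ-pull g Λ (Ψ ⊙ X) Λ-local g∉Λ) ⟨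
    Σ[ f ] (Σ[ g ] (Λ ⊙ (Ψ ⊙ X)))   ≈⟨ Σ-comm f g _ f≢g (Local-⊙ Λ-local (Local-⊙ Ψ-local X-local)) ⟩
    Σ[ g ] (Σ[ f ] (Λ ⊙ (Ψ ⊙ X)))   ≈⟨ Σ-cong g (Σ-cong f (⊙.x∙yz≈z∙xy Λ Ψ X)) ⟩
    Σ[ g ] (Σ[ f ] (X ⊙ (Λ ⊙ Ψ)))   ≈⟨ Σ-cong g (Σ-pull f X (Λ ⊙ Ψ) X-local f∉X) ⟩
    Σ[ g ] (X ⊙ (Σ[ f ] (Λ ⊙ Ψ)))   ≈⟨ Σ-cong g (⊙-comm X _) ⟩
    Σ[ g ] ((Σ[ f ] (Λ ⊙ Ψ)) ⊙ X)   ∎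
    where open SetoidReasoning Factor-setoid

  ∉-marginalise : ∀ g {f F Γ} → f ∉ fvars F → All (λ φ → f ∉ fvars φ) Γ →
                  f ∉ fvars (marginalise g F Γ)
  ∉-marginalise g {F = F} f∉F f∉Γ f∈ =
    [ f∉F , ∉-fvars-⨀ (All-mentions g f∉Γ) ] (∈-++⁻ (fvars F) (proj₁ (∈-∖⁻ f∈)))

  Independent : Var → Factor → Maybe Var → Set
  Independent f Λ m = ∀ {g} → m ≡ just g → g ≢ f × g ∉ fvars Λ

  -- The invariant carried through the later bindings in S₂ and S₃.
  record Contraction (f : Var) (Λ : Factor) (Δ Δ' : List Factor) : Set (c ⊔ ℓ) where
    field
      old new    : Factor
      rest       : List Factor
      Δ↭         : Δ ↭ old ∷ rest
      Δ'↭        : Δ' ↭ new ∷ rest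
      Σ-new      : (Σ[ f ] (Λ ⊙ new)) ≈F old
      f∈new      : f ∈ fvars new
      new-local  : Local new
      f∉rest     : All (λ φ → f ∉ fvars φ) rest
      rest-local : All Local rest

  sumOut-contraction : ∀ {f Λ Δ Δ'} → Contraction f Λ Δ Δ' → sumOut f Λ Δ' ↭ Δ
  sumOut-contraction {f} {Λ} {Δ} {Δ'} C = begin
    sumOut f Λ Δ'
      ↭⟨ sumOut-cong f (≈F-refl {Λ}) Δ'↭ ⟩
    sumOut f Λ (new ∷ rest)
      ≡⟨ sumOut-∷-∈ f Λ rest f∈new ⟩
    (Σ[ f ] (Λ ⊙ (new ⊙ ⨀ (mentions f rest)))) ∷ avoids f rest
      ≡⟨ cong₂ (λ M A → (Σ[ f ] (Λ ⊙ (new ⊙ ⨀ M))) ∷ A)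
               (mentions-none f f∉rest) (avoids-all f f∉rest) ⟩
    (Σ[ f ] (Λ ⊙ (new ⊙ unitF))) ∷ rest
      ↭⟨ prep (≈F-trans (Σ-cong f (⊙-cong (≈F-refl {Λ}) (⊙-identityʳ new))) Σ-new) ↭-refl ⟩
    old ∷ rest
      ↭⟨ Δ↭ ⟨
    Δ ∎
    where
    open Contraction C
    open PermutationReasoning

  contraction-start : ∀ {f Λ Φ Ψ Γ} m → (Σ[ f ] (Λ ⊙ Ψ)) ≈F Φ → f ∈ fvars Ψ → Local Ψ → Local Λ →
                      All (λ φ → f ∉ fvars φ) Γ → All Local Γ → Independent f Λ m →
                      Contraction f Λ (addFactor m Φ Γ) (addFactor m Ψ Γ)
  contraction-start {Φ = Φ} {Ψ} {Γ} nothing Σ-Ψ f∈Ψ Ψ-local _ f∉Γ Γ-local _ = record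
    { old = Φ ; new = Ψ ; rest = Γ ; Δ↭ = ↭-refl ; Δ'↭ = ↭-refl ; Σ-new = Σ-Ψ ; f∈new = f∈Ψ
    ; new-local = Ψ-local ; f∉rest = f∉Γ ; rest-local = Γ-local }
  contraction-start {f} {Λ} {Φ} {Ψ} {Γ} (just g) Σ-Ψ f∈Ψ Ψ-local Λ-local f∉Γ Γ-local ind = record
    { old = marginalise g Φ Γ ; new = marginalise g Ψ Γ ; rest = avoids g Γ ; Δ↭ = ↭-refl ; Δ'↭ = ↭-refl
    ; Σ-new = ≈F-trans
        (Σ-exchange f g Λ Ψ X f≢g g∉Λ (∉-fvars-⨀ (All-mentions g f∉Γ)) Λ-local Ψ-local X-local)
        (Σ-cong g (⊙-cong Σ-Ψ (≈F-refl {X})))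
    ; f∈new = ∈-∖⁺ (∈-++⁺ˡ f∈Ψ) (∉-singleton f≢g)
    ; new-local = Local-marginalise g Ψ-local Γ-local
    ; f∉rest = All-avoids g f∉Γ ; rest-local = All-avoids g Γ-local }
    where
    X = ⨀ (mentions g Γ)
    X-local = Local-⨀ (All-mentions g Γ-local)
    f≢g = proj₁ (ind refl) ∘ sym
    g∉Λ = proj₂ (ind refl)

  module _ {f Λ Δ Δ'} (C : Contraction f Λ Δ Δ') (g : Var) {F : Factor}
           (f∉F : f ∉ fvars F) (F-local : Local F) (Λ-local : Local Λ)
           (g≢f : g ≢ f) (g∉Λ : g ∉ fvars Λ) where
    open Contraction C

    contraction-sumOut-∈ : g ∈ fvars new → Contraction f Λ (sumOut g F Δ) (sumOut g F Δ')
    contraction-sumOut-∈ g∈new = record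
      { old = Σ[ g ] (F ⊙ (old ⊙ X)) ; new = Σ[ g ] (F ⊙ (new ⊙ X)) ; rest = avoids g rest
      ; Δ↭ = ↭-trans (sumOut-cong g (≈F-refl {F}) Δ↭) (↭-reflexive (sumOut-∷-∈ g F rest g∈old))
      ; Δ'↭ = ↭-trans (sumOut-cong g (≈F-refl {F}) Δ'↭) (↭-reflexive (sumOut-∷-∈ g F rest g∈new))
      ; Σ-new = Σ-new'
      ; f∈new = ∈-∖⁺ (∈-++⁺ʳ (fvars F) (∈-++⁺ˡ f∈new)) (∉-singleton (g≢f ∘ sym))
      ; new-local = Local-Σ g (Local-⊙ F-local (Local-⊙ new-local X-local))
      ; f∉rest = All-avoids g f∉rest ; rest-local = All-avoids g rest-local }
      where
      X = ⨀ (mentions g rest)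
      X-local = Local-⨀ (All-mentions g rest-local)
      g∈old : g ∈ fvars old
      g∈old = ≐⇒⊆ (proj₁ Σ-new) (∈-∖⁺ (∈-++⁺ʳ (fvars Λ) g∈new) (∉-singleton g≢f))
      f∉FX : f ∉ fvars (F ⊙ X)
      f∉FX f∈ = [ f∉F , ∉-fvars-⨀ (All-mentions g f∉rest) ] (∈-++⁻ (fvars F) f∈)
      Σ-new' : (Σ[ f ] (Λ ⊙ (Σ[ g ] (F ⊙ (new ⊙ X))))) ≈F (Σ[ g ] (F ⊙ (old ⊙ X)))
      Σ-new' = begin
        Σ[ f ] (Λ ⊙ (Σ[ g ] (F ⊙ (new ⊙ X))))
          ≈⟨ Σ-cong f (⊙-cong (≈F-refl {Λ}) (Σ-cong g (⊙.x∙yz≈y∙xz F new X))) ⟩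
        Σ[ f ] (Λ ⊙ (Σ[ g ] (new ⊙ (F ⊙ X))))
          ≈⟨ Σ-exchange f g Λ new (F ⊙ X) (g≢f ∘ sym) g∉Λ f∉FX
                        Λ-local new-local (Local-⊙ F-local X-local) ⟩
        Σ[ g ] ((Σ[ f ] (Λ ⊙ new)) ⊙ (F ⊙ X))
          ≈⟨ Σ-cong g (⊙-cong Σ-new (≈F-refl {F ⊙ X})) ⟩
        Σ[ g ] (old ⊙ (F ⊙ X))
          ≈⟨ Σ-cong g (⊙.x∙yz≈y∙xz old F X) ⟩
        Σ[ g ] (F ⊙ (old ⊙ X))
          ∎
        where open SetoidReasoning Factor-setoid

    contraction-sumOut-∉ : g ∉ fvars new → Contraction f Λ (sumOut g F Δ) (sumOut g F Δ')
    contraction-sumOut-∉ g∉new = record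
      { old = old ; new = new ; rest = S ∷ avoids g rest
      ; Δ↭ = ↭-trans (sumOut-cong g (≈F-refl {F}) Δ↭)
               (↭-trans (↭-reflexive (sumOut-∷-∉ g F rest g∉old)) (↭-swap S old ↭-refl))
      ; Δ'↭ = ↭-trans (sumOut-cong g (≈F-refl {F}) Δ'↭)
               (↭-trans (↭-reflexive (sumOut-∷-∉ g F rest g∉new)) (↭-swap S new ↭-refl))
      ; Σ-new = Σ-new ; f∈new = f∈new ; new-local = new-local
      ; f∉rest = ∉-marginalise g {F = F} {rest} f∉F f∉rest ∷ All-avoids g f∉rest
      ; rest-local = Local-marginalise g F-local rest-local ∷ All-avoids g rest-local }
      where
      S = marginalise g F rest
      g∉old : g ∉ fvars old
      g∉old g∈ = [ g∉Λ , g∉new ] (∈-++⁻ (fvars Λ) (proj₁ (∈-∖⁻ (≐⇒⊇ (proj₁ Σ-new) g∈))))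

  contraction-addFactor : ∀ {f Λ Δ Δ'} m F → Contraction f Λ Δ Δ' → f ∉ fvars F → Local F → Local Λ →
                          Independent f Λ m → Contraction f Λ (addFactor m F Δ) (addFactor m F Δ')
  contraction-addFactor nothing F C f∉F F-local _ _ = record
    { old = old ; new = new ; rest = F ∷ rest
    ; Δ↭ = ↭-trans (↭-prep F Δ↭) (↭-swap F old ↭-refl)
    ; Δ'↭ = ↭-trans (↭-prep F Δ'↭) (↭-swap F new ↭-refl)
    ; Σ-new = Σ-new ; f∈new = f∈new ; new-local = new-local
    ; f∉rest = f∉F ∷ f∉rest ; rest-local = F-local ∷ rest-local }
    where open Contraction C
  contraction-addFactor (just g) F C f∉F F-local Λ-local ind with g ∈? fvars (Contraction.new C)
  ... | yes g∈new = contraction-sumOut-∈ C g f∉F F-local Λ-local g≢f g∉Λ g∈new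
    where g≢f = proj₁ (ind refl) ; g∉Λ = proj₂ (ind refl)
  ... | no g∉new  = contraction-sumOut-∉ C g f∉F F-local Λ-local g≢f g∉Λ g∉new
    where g≢f = proj₁ (ind refl) ; g∉Λ = proj₂ (ind refl)

  -- The factors of the redexes of S₂ and S₃

  Σ-Fact-β-vars : ∀ x e₂ v₂ f → pvars x ⊆ FV e₂ → f ∉ FV e₂ → f ∉ pvars v₂ →
    fvars (Σ[ f ] (Fact (pv f) (lam x e₂) ⊙ Fact v₂ (app f x))) ≐ fvars (Fact v₂ e₂)
  Σ-Fact-β-vars x e₂ v₂ f x⊆e₂ f∉e₂ f∉v₂ = ⊆⊇⇒≐ to from
    where
    to : fvars (Σ[ f ] (Fact (pv f) (lam x e₂) ⊙ Fact v₂ (app f x))) ⊆ fvars (Fact v₂ e₂)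
    to u∈ with ∈-∖⁻ u∈
    ... | u∈L , u∉[f] with ∈-++⁻ ((FV e₂ ∖ pvars x) ++ (f ∷ [])) u∈L
    ...   | inj₁ u∈λ with ∈-++⁻ (FV e₂ ∖ pvars x) u∈λ
    ...     | inj₁ u∈e₂∖x = ∈-++⁺ˡ (proj₁ (∈-∖⁻ {xs = FV e₂} u∈e₂∖x))
    ...     | inj₂ u∈[f]  = ⊥-elim (u∉[f] u∈[f])
    to u∈ | u∈L , u∉[f] | inj₂ (here u≡f) = ⊥-elim (u∉[f] (here u≡f))
    to u∈ | u∈L , u∉[f] | inj₂ (there u∈xv₂) with ∈-++⁻ (pvars x) u∈xv₂
    ...     | inj₁ u∈x  = ∈-++⁺ˡ (x⊆e₂ u∈x)
    ...     | inj₂ u∈v₂ = ∈-++⁺ʳ (FV e₂) u∈v₂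
    from : fvars (Fact v₂ e₂) ⊆ fvars (Σ[ f ] (Fact (pv f) (lam x e₂) ⊙ Fact v₂ (app f x)))
    from {u} u∈ with ∈-++⁻ (FV e₂) u∈
    ... | inj₂ u∈v₂ =
      ∈-∖⁺ (∈-++⁺ʳ ((FV e₂ ∖ pvars x) ++ (f ∷ [])) (there (∈-++⁺ʳ (pvars x) u∈v₂)))
           (∉-singleton λ u≡f → f∉v₂ (subst (_∈ pvars v₂) u≡f u∈v₂))
    ... | inj₁ u∈e₂ with u ∈? pvars x
    ...   | yes u∈x = ∈-∖⁺ (∈-++⁺ʳ ((FV e₂ ∖ pvars x) ++ (f ∷ [])) (there (∈-++⁺ˡ u∈x))) u∉[f]
      where u∉[f] = ∉-singleton λ u≡f → f∉e₂ (subst (_∈ FV e₂) u≡f u∈e₂)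
    ...   | no u∉x  = ∈-∖⁺ (∈-++⁺ˡ (∈-++⁺ˡ (∈-∖⁺ u∈e₂ u∉x))) u∉[f]
      where u∉[f] = ∉-singleton λ u≡f → f∉e₂ (subst (_∈ FV e₂) u≡f u∈e₂)

  Σ-Fact-β : ∀ x e₂ v₂ f → ty f ≡ pty x ⊸ pty v₂ → e₂ ∶ pty v₂ →
             pvars x ⊆ FV e₂ → f ∉ FV e₂ → f ∉ pvars v₂ →
             (Σ[ f ] (Fact (pv f) (lam x e₂) ⊙ Fact v₂ (app f x))) ≈F Fact v₂ e₂
  Σ-Fact-β x e₂ v₂ (k , _) refl e₂-typed x⊆e₂ f∉e₂ f∉v₂ =
    Σ-Fact-β-vars x e₂ v₂ f x⊆e₂ f∉e₂ f∉v₂ , values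
    where
    f : Var
    f = k , pty x ⊸ pty v₂
    values : ∀ ρ → TypedEnv ρ →
             fn (Σ[ f ] (Fact (pv f) (lam x e₂) ⊙ Fact v₂ (app f x))) ρ ≈ ⟦ e₂ ⟧ ρ (patVal v₂ ρ)
    values ρ t rewrite dec-true (f ∈? fvars (Fact (pv f) (lam x e₂) ⊙ Fact v₂ (app f x)))
                                (∈-++⁺ˡ (∈-++⁺ʳ (FV e₂ ∖ pvars x) (here refl))) = begin
      ∑ (elems (pty x ⊸ pty v₂)) K
        ≈⟨ ∑-cartesianProductWith ⟨_,_⟩ (elems (pty x)) (elems (pty v₂)) K ⟩
      ∑ (elems (pty x)) (λ b₁ → ∑ (elems (pty v₂)) (λ b₂ → K ⟨ b₁ , b₂ ⟩))
        ≈⟨ ∑-cong (elems (pty x)) (λ {b₁} _ →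
             ≈-trans (∑-cong (elems (pty v₂)) (K-δ b₁)) (≈-sym (∑-*ˡ (elems (pty v₂)) _ _))) ⟩
      ∑ (elems (pty x)) (λ b₁ → δ b₁ cx * ∑ (elems (pty v₂)) (λ b₂ → δ b₂ cv * H b₁ b₂))
        ≈⟨ ∑-δ (pty x) (patVal-typed x t) (λ b₁ → ∑ (elems (pty v₂)) (λ b₂ → δ b₂ cv * H b₁ b₂)) ⟩
      ∑ (elems (pty v₂)) (λ b₂ → δ b₂ cv * H cx b₂)
        ≈⟨ ∑-δ (pty v₂) (patVal-typed v₂ t) (H cx) ⟩
      H cx cv
        ≡⟨ ⟦⟧-local e₂-typed (patVal-typed v₂ t) (λ {u} _ → bind-patVal x (λ _ → refl) u) ⟩
      ⟦ e₂ ⟧ ρ cv ∎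
      where
      open SetoidReasoning setoid
      cx = patVal x ρ
      cv = patVal v₂ ρ
      ρ[_] : Val → Env
      ρ[ a ] = ρ [ f ↦ a ]
      K : Val → C
      K a = ⟦ lam x e₂ ⟧ ρ[ a ] (ρ[ a ] f) * appSem (ρ[ a ] f) (patVal x ρ[ a ]) (patVal v₂ ρ[ a ])
      H : Val → Val → C
      H b₁ b₂ = ⟦ e₂ ⟧ (bind x b₁ ρ) b₂
      ≢f : ∀ {u} → u ∈ FV e₂ → u ≢ f
      ≢f u∈ u≡f = f∉e₂ (subst (_∈ FV e₂) u≡f u∈)
      K-δ : ∀ b₁ {b₂} → b₂ ∈ elems (pty v₂) → K ⟨ b₁ , b₂ ⟩ ≈ δ b₁ cx * (δ b₂ cv * H b₁ b₂)
      K-δ b₁ {b₂} b₂∈ = begin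
        K ⟨ b₁ , b₂ ⟩
          ≡⟨ cong (λ a → ⟦ lam x e₂ ⟧ ρ' a * appSem a (patVal x ρ') (patVal v₂ ρ')) (↦-same ρ f ⟨ b₁ , b₂ ⟩) ⟩
        ⟦ e₂ ⟧ (bind x b₁ ρ') b₂ * (δ b₁ (patVal x ρ') * δ b₂ (patVal v₂ ρ'))
          ≡⟨ cong₂ _*_
               (⟦⟧-local e₂-typed (∈-elems⁻ _ b₂∈) (λ {u} u∈ → bind-cong x b₁ {ρ'} {ρ} u (↦-other ρ _ (≢f u∈))))
               (cong₂ (λ a a' → δ b₁ a * δ b₂ a')
                  (patVal-cong x (λ u∈ → ↦-other ρ _ (≢f (x⊆e₂ u∈))))
                  (patVal-cong v₂ (λ u∈ → ↦-other ρ _ λ u≡f → f∉v₂ (subst (_∈ pvars v₂) u≡f u∈)))) ⟩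
        H b₁ b₂ * (δ b₁ cx * δ b₂ cv)
          ≈⟨ ≈-trans (*-comm _ _) (*-assoc _ _ _) ⟩
        δ b₁ cx * (δ b₂ cv * H b₁ b₂) ∎
        where ρ' = ρ[ ⟨ b₁ , b₂ ⟩ ]

  FV-patExpr : ∀ p → FV (patExpr p) ≡ pvars p
  FV-patExpr (pv v)   = refl
  FV-patExpr (pp p q) = cong₂ _++_ (FV-patExpr p) (FV-patExpr q)

  ⟦patExpr⟧ : ∀ p σ b → ⟦ patExpr p ⟧ σ b ≈ δ (patVal p σ) b
  ⟦patExpr⟧ (pv v)   σ b             = ≈-refl
  ⟦patExpr⟧ (pp p q) σ vt            = ≈-refl
  ⟦patExpr⟧ (pp p q) σ vf            = ≈-refl
  ⟦patExpr⟧ (pp p q) σ ⟨ b₁ , b₂ ⟩ =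
    ≈-trans (*-cong (⟦patExpr⟧ p σ b₁) (⟦patExpr⟧ q σ b₂)) (≈-sym (δ-pair (patVal p σ) (patVal q σ) b₁ b₂))

  pvars-pairPat : ∀ m w → pvars (pairPat m w) ≡ pvarsᴹ m ++ pvars w
  pvars-pairPat nothing  w = refl
  pvars-pairPat (just p) w = refl

  FV-pairExpr : ∀ m e → FV (pairExpr m e) ≡ pvarsᴹ m ++ FV e
  FV-pairExpr nothing  e = refl
  FV-pairExpr (just p) e = cong (_++ FV e) (FV-patExpr p)

  δ-on : Maybe Pat → Env → Env → C
  δ-on nothing  σ ρ = 1#
  δ-on (just p) σ ρ = δ (patVal p σ) (patVal p ρ)

  δ-on-cong : ∀ m {σ σ'} ρ → (∀ y → σ y ≡ σ' y) → δ-on m σ ρ ≡ δ-on m σ' ρ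
  δ-on-cong nothing  ρ σ≗σ' = refl
  δ-on-cong (just p) ρ σ≗σ' = cong (λ a → δ a (patVal p ρ)) (patVal-cong p (λ {u} _ → σ≗σ' u))

  δ-on-posPart-pp : ∀ p q → Pos (pty p) → ∀ σ ρ →
                    δ-on (posPart (pp p q)) σ ρ ≈ δ (patVal p σ) (patVal p ρ) * δ-on (posPart q) σ ρ
  δ-on-posPart-pp p q P σ ρ rewrite posPart-Pos p P with posPart q
  ... | nothing = ≈-sym (*-identityʳ _)
  ... | just q⁺ = δ-pair (patVal p σ) (patVal q⁺ σ) (patVal p ρ) (patVal q⁺ ρ)

  ⟦pairExpr⟧ : ∀ m e w σ ρ → ⟦ pairExpr m e ⟧ σ (patVal (pairPat m w) ρ) ≈ δ-on m σ ρ * ⟦ e ⟧ σ (patVal w ρ)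
  ⟦pairExpr⟧ nothing  e w σ ρ = ≈-sym (*-identityˡ _)
  ⟦pairExpr⟧ (just p) e w σ ρ = *-congʳ (⟦patExpr⟧ p σ (patVal p ρ))

  -- Fixing the positive part of v to its value in ρ leaves f as the only summation variable.
  ∑-bind-arrow : ∀ v {f} → WfPat v → arrowVar v ≡ just f → ∀ ρ → TypedEnv ρ → (G : Val → Env → C) →
                 (∀ u {σ σ'} → (∀ y → σ y ≡ σ' y) → G u σ ≈ G u σ') →
                 ∑ (elems (pty v)) (λ u → δ-on (posPart v) (bind v u ρ) ρ * G u (bind v u ρ))
                 ≈ ∑ (elems (ty f)) (λ a → G (patVal v (ρ [ f ↦ a ])) (ρ [ f ↦ a ]))
  ∑-bind-arrow (pv v) _ eq ρ _ G _ with isArr (ty v)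
  ∑-bind-arrow (pv v) _ refl ρ _ G _ | true = ∑-cong (elems (ty v)) λ {a} _ →
    ≈-trans (*-identityˡ _) (reflexive (cong (λ u → G u (ρ [ v ↦ a ])) (sym (↦-same ρ v a))))
  ∑-bind-arrow (pp p q) {f} (wf-p p-wf q-wf P p#q) eq ρ t G G-ext = begin
    ∑ (elems (pty p ⊗ pty q)) (λ u → δ-on (posPart (pp p q)) (bind (pp p q) u ρ) ρ * G u (bind (pp p q) u ρ))
      ≈⟨ ≈-trans (∑-cartesianProductWith ⟨_,_⟩ (elems (pty p)) (elems (pty q)) _)
                 (∑-cong (elems (pty p)) λ u₁∈ →
                   ≈-trans (∑-cong (elems (pty q)) λ _ → split u₁∈) (≈-sym (∑-*ˡ (elems (pty q)) _ _))) ⟩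
    ∑ (elems (pty p)) (λ u₁ → δ u₁ c₀ * J u₁)
      ≈⟨ ∑-δ (pty p) (patVal-typed p t) J ⟩
    J c₀
      ≈⟨ ∑-cong (elems (pty q)) (λ {u₂} _ → *-cong (reflexive (δ-on-cong (posPart q) ρ (unbind-p u₂)))
                                                    (G-ext ⟨ c₀ , u₂ ⟩ (unbind-p u₂))) ⟩
    ∑ (elems (pty q)) (λ u₂ → δ-on (posPart q) (bind q u₂ ρ) ρ * G ⟨ c₀ , u₂ ⟩ (bind q u₂ ρ))
      ≈⟨ ∑-bind-arrow q q-wf q-arrow ρ t (λ u → G ⟨ c₀ , u ⟩) (λ u → G-ext ⟨ c₀ , u ⟩) ⟩
    ∑ (elems (ty f)) (λ a → G ⟨ c₀ , patVal q (ρ [ f ↦ a ]) ⟩ (ρ [ f ↦ a ]))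
      ≡⟨ ∑-cong-≡ (elems (ty f)) (λ {a} _ →
           cong (λ b → G ⟨ b , patVal q (ρ [ f ↦ a ]) ⟩ (ρ [ f ↦ a ])) (sym (p-↦ a))) ⟩
    ∑ (elems (ty f)) (λ a → G (patVal (pp p q) (ρ [ f ↦ a ])) (ρ [ f ↦ a ])) ∎
    where
    open SetoidReasoning setoid
    c₀ = patVal p ρ
    σ : Val → Val → Env
    σ u₁ u₂ = bind q u₂ (bind p u₁ ρ)
    J : Val → C
    J u₁ = ∑ (elems (pty q)) (λ u₂ → δ-on (posPart q) (σ u₁ u₂) ρ * G ⟨ u₁ , u₂ ⟩ (σ u₁ u₂))
    q-arrow : arrowVar q ≡ just f
    q-arrow = subst (λ m → (m <∣> arrowVar q) ≡ just f) (arrowVar-nothing p (Pos-pvars p P)) eq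
    p-bound : ∀ {u₁} u₂ → u₁ ∈ elems (pty p) → patVal p (σ u₁ u₂) ≡ u₁
    p-bound u₂ u₁∈ =
      trans (patVal-cong p (λ u∈p → bind-∉ q u₂ _ (p#q u∈p))) (patVal-bind p ρ p-wf (∈-elems⁻ _ u₁∈))
    split : ∀ {u₁ u₂} → u₁ ∈ elems (pty p) →
            δ-on (posPart (pp p q)) (σ u₁ u₂) ρ * G ⟨ u₁ , u₂ ⟩ (σ u₁ u₂)
            ≈ δ u₁ c₀ * (δ-on (posPart q) (σ u₁ u₂) ρ * G ⟨ u₁ , u₂ ⟩ (σ u₁ u₂))
    split {u₁} {u₂} u₁∈ = ≈-trans (*-congʳ (δ-on-posPart-pp p q P (σ u₁ u₂) ρ))
      (≈-trans (*-assoc _ _ _) (*-congʳ (reflexive (cong (λ a → δ a c₀) (p-bound u₂ u₁∈)))))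
    unbind-p : ∀ u₂ y → σ c₀ u₂ y ≡ bind q u₂ ρ y
    unbind-p u₂ y = bind-cong q u₂ {bind p c₀ ρ} {ρ} y (bind-patVal p (λ _ → refl) y)
    p-↦ : ∀ a → patVal p (ρ [ f ↦ a ]) ≡ c₀
    p-↦ a = patVal-cong p λ u∈p →
      ↦-other ρ a (Positive⇒≢ (Pos-pvars p P u∈p) (proj₂ (arrowVar-just⁻ (pp p q) eq)))

  arrowVar-pairPat : ∀ v w → arrowVar (pairPat (posPart v) w) ≡ arrowVar w
  arrowVar-pairPat v w with posPart v in v⁺
  ... | nothing = refl
  ... | just p = cong (_<∣> arrowVar w) (arrowVar-nothing p p-positive)
    where
    p-positive : ∀ {y} → y ∈ pvars p → Positive y
    p-positive {y} y∈p = proj₂ (∈-posPart⁻ v (subst (λ m → y ∈ pvarsᴹ m) (sym v⁺) y∈p))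

  module _ (v₁ : Pat) (e₁ : Expr) (v₂ : Pat) (e₂ : Expr) {f : Var}
           (v₁-wf : WfPat v₁) (v₁-arrow : arrowVar v₁ ≡ just f)
           (f∉e₁ : f ∉ FV e₁) (v₁#v₂ : Disjoint (pvars v₁) (pvars v₂)) where

    private
      v₁⁺ = posPart v₁
      merged = elet v₁ e₁ (pairExpr v₁⁺ e₂)
      f∈v₁ = proj₁ (arrowVar-just⁻ v₁ v₁-arrow)
      f-arrow = proj₂ (arrowVar-just⁻ v₁ v₁-arrow)

    Σ-Fact-let-vars : fvars (Σ[ f ] (Fact v₁ e₁ ⊙ Fact v₂ e₂)) ≐ fvars (Fact (pairPat v₁⁺ v₂) merged)
    Σ-Fact-let-vars = ⊆⊇⇒≐ to from
      where
      ≢f : ∀ {u xs} → f ∉ xs → u ∈ xs → u ∉ f ∷ []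
      ≢f {xs = xs} f∉ u∈ = ∉-singleton λ u≡f → f∉ (subst (_∈ xs) u≡f u∈)
      in-output : ∀ {u} → u ∈ pvarsᴹ v₁⁺ ++ pvars v₂ → u ∈ fvars (Fact (pairPat v₁⁺ v₂) merged)
      in-output u∈ = ∈-++⁺ʳ _ (subst (_ ∈_) (sym (pvars-pairPat v₁⁺ v₂)) u∈)
      in-v₁⁺ : ∀ {u} → u ∈ pvars v₁ → u ∉ f ∷ [] → u ∈ fvars (Fact (pairPat v₁⁺ v₂) merged)
      in-v₁⁺ u∈v₁ u≢f =
        in-output (∈-++⁺ˡ (∈-posPart⁺ v₁ u∈v₁ (arrowVar-other v₁ v₁-wf v₁-arrow u∈v₁ (u≢f ∘ here))))
      to : fvars (Σ[ f ] (Fact v₁ e₁ ⊙ Fact v₂ e₂)) ⊆ fvars (Fact (pairPat v₁⁺ v₂) merged)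
      to {u} u∈ with ∈-∖⁻ u∈
      ... | u∈L , u≢f with ∈-++⁻ (FV e₁ ++ pvars v₁) u∈L
      ...   | inj₁ u∈e₁v₁ = [ ∈-++⁺ˡ ∘ ∈-++⁺ˡ , (λ u∈v₁ → in-v₁⁺ u∈v₁ u≢f) ] (∈-++⁻ (FV e₁) u∈e₁v₁)
      ...   | inj₂ u∈e₂v₂ with ∈-++⁻ (FV e₂) u∈e₂v₂
      ...     | inj₂ u∈v₂ = in-output (∈-++⁺ʳ (pvarsᴹ v₁⁺) u∈v₂)
      ...     | inj₁ u∈e₂ with u ∈? pvars v₁
      ...       | yes u∈v₁ = in-v₁⁺ u∈v₁ u≢f
      ...       | no u∉v₁  = ∈-++⁺ˡ (∈-++⁺ʳ (FV e₁) (∈-∖⁺ u∈pair u∉v₁))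
        where u∈pair = subst (_ ∈_) (sym (FV-pairExpr v₁⁺ e₂)) (∈-++⁺ʳ (pvarsᴹ v₁⁺) u∈e₂)
      from : fvars (Fact (pairPat v₁⁺ v₂) merged) ⊆ fvars (Σ[ f ] (Fact v₁ e₁ ⊙ Fact v₂ e₂))
      from {u} u∈ with ∈-++⁻ (FV e₁ ++ (FV (pairExpr v₁⁺ e₂) ∖ pvars v₁)) u∈
      ... | inj₁ u∈body with ∈-++⁻ (FV e₁) u∈body
      ...   | inj₁ u∈e₁ = ∈-∖⁺ (∈-++⁺ˡ (∈-++⁺ˡ u∈e₁)) (≢f f∉e₁ u∈e₁)
      ...   | inj₂ u∈e₂∖v₁ with ∈-∖⁻ {xs = FV (pairExpr v₁⁺ e₂)} u∈e₂∖v₁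
      ...     | u∈pair , u∉v₁ with ∈-++⁻ (pvarsᴹ v₁⁺) (subst (_ ∈_) (FV-pairExpr v₁⁺ e₂) u∈pair)
      ...       | inj₁ u∈v₁⁺ = ⊥-elim (u∉v₁ (proj₁ (∈-posPart⁻ v₁ u∈v₁⁺)))
      ...       | inj₂ u∈e₂ = ∈-∖⁺ (∈-++⁺ʳ (FV e₁ ++ pvars v₁) (∈-++⁺ˡ u∈e₂))
                                   (∉-singleton λ u≡f → u∉v₁ (subst (_∈ pvars v₁) (sym u≡f) f∈v₁))
      from {u} u∈ | inj₂ u∈out with ∈-++⁻ (pvarsᴹ v₁⁺) (subst (_ ∈_) (pvars-pairPat v₁⁺ v₂) u∈out)
      ...   | inj₁ u∈v₁⁺ = let u∈v₁ , u-pos = ∈-posPart⁻ v₁ u∈v₁⁺ in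
                           ∈-∖⁺ (∈-++⁺ˡ (∈-++⁺ʳ (FV e₁) u∈v₁)) (∉-singleton (Positive⇒≢ u-pos f-arrow))
      ...   | inj₂ u∈v₂  = ∈-∖⁺ (∈-++⁺ʳ (FV e₁ ++ pvars v₁) (∈-++⁺ʳ (FV e₂) u∈v₂)) (≢f (v₁#v₂ f∈v₁) u∈v₂)

    Σ-Fact-let : e₁ ∶ pty v₁ → e₂ ∶ pty v₂ →
                 (Σ[ f ] (Fact v₁ e₁ ⊙ Fact v₂ e₂))
                 ≈F Fact (pairPat (posPart v₁) v₂) (elet v₁ e₁ (pairExpr (posPart v₁) e₂))
    Σ-Fact-let e₁-typed e₂-typed = Σ-Fact-let-vars , values
      where
      values : ∀ ρ → TypedEnv ρ →
               fn (Σ[ f ] (Fact v₁ e₁ ⊙ Fact v₂ e₂)) ρ ≈ ⟦ merged ⟧ ρ (patVal (pairPat v₁⁺ v₂) ρ)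
      values ρ t rewrite dec-true (f ∈? fvars (Fact v₁ e₁ ⊙ Fact v₂ e₂)) (∈-++⁺ˡ (∈-++⁺ʳ (FV e₁) f∈v₁)) =
        ≈-sym (begin
        ∑ (elems (pty v₁)) (λ u → ⟦ e₁ ⟧ ρ u * ⟦ pairExpr v₁⁺ e₂ ⟧ (bind v₁ u ρ) (patVal (pairPat v₁⁺ v₂) ρ))
          ≈⟨ ∑-cong (elems (pty v₁)) (λ {u} _ →
               ≈-trans (*-congˡ (⟦pairExpr⟧ v₁⁺ e₂ v₂ (bind v₁ u ρ) ρ)) (*.x∙yz≈y∙xz _ _ _)) ⟩
        ∑ (elems (pty v₁)) (λ u → δ-on v₁⁺ (bind v₁ u ρ) ρ * G u (bind v₁ u ρ))
          ≈⟨ ∑-bind-arrow v₁ v₁-wf v₁-arrow ρ t G (λ u σ≗σ' →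
               *-congˡ (reflexive (⟦⟧-local e₂-typed (patVal-typed v₂ t) (λ {y} _ → σ≗σ' y)))) ⟩
        ∑ (elems (ty f)) (λ a → G (patVal v₁ ρ[ a ]) ρ[ a ])
          ≡⟨ ∑-cong-≡ (elems (ty f)) (λ {a} a∈ → cong₂ _*_
               (⟦⟧-local e₁-typed (patVal-typed v₁ (↦-typed f t (∈-elems⁻ _ a∈)))
                         (λ y∈ → sym (↦-agree-∉ (FV e₁) f a ρ f∉e₁ y∈)))
               (cong (⟦ e₂ ⟧ ρ[ a ]) (patVal-cong v₂ λ y∈ →
                 sym (↦-other ρ a λ y≡f → v₁#v₂ f∈v₁ (subst (_∈ pvars v₂) y≡f y∈))))) ⟩
        ∑ (elems (ty f)) (λ a → ⟦ e₁ ⟧ ρ[ a ] (patVal v₁ ρ[ a ]) * ⟦ e₂ ⟧ ρ[ a ] (patVal v₂ ρ[ a ])) ∎)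
        where
        open SetoidReasoning setoid
        ρ[_] : Val → Env
        ρ[ a ] = ρ [ f ↦ a ]
        G : Val → Env → C
        G u σ = ⟦ e₁ ⟧ ρ u * ⟦ e₂ ⟧ σ (patVal v₂ ρ)

  -- Let-terms and swap steps

  allVars-pvars : ∀ v e l → pvars v ⊆ allVars (lett v e l)
  allVars-pvars v e l = ∈-++⁺ˡ ∘ ∈-++⁺ˡ

  allVars-FV : ∀ v e l → FV e ⊆ allVars (lett v e l)
  allVars-FV v e l = ∈-++⁺ʳ (BV (toExpr (lett v e l))) ∘ ∈-++⁺ˡ

  allVars-tail : ∀ v e l → allVars l ⊆ allVars (lett v e l)
  allVars-tail v e l {y} y∈ with ∈-++⁻ (BV (toExpr l)) y∈
  ... | inj₁ y∈BV = ∈-++⁺ˡ (∈-++⁺ʳ (pvars v) (∈-++⁺ʳ (BV e) y∈BV))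
  ... | inj₂ y∈FV with y ∈? pvars v
  ...   | yes y∈v = allVars-pvars v e l y∈v
  ...   | no y∉v  = ∈-++⁺ʳ (BV (toExpr (lett v e l))) (∈-++⁺ʳ (FV e) (∈-∖⁺ y∈FV y∉v))

  output-⊆-allVars : ∀ l → pvars (output l) ⊆ allVars l
  output-⊆-allVars (out w)      = ∈-++⁺ʳ (BV (patExpr w)) ∘ subst (_ ∈_) (sym (FV-patExpr w))
  output-⊆-allVars (lett v e l) = allVars-tail v e l ∘ output-⊆-allVars l

  All-addFactor-∉ : ∀ m {f F Γ} → f ∉ fvars F → All (λ φ → f ∉ fvars φ) Γ →
                    All (λ φ → f ∉ fvars φ) (addFactor m F Γ)
  All-addFactor-∉ nothing  f∉F f∉Γ = f∉F ∷ f∉Γ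
  All-addFactor-∉ (just g) {F = F} {Γ} f∉F f∉Γ = ∉-marginalise g {F = F} {Γ} f∉F f∉Γ ∷ All-avoids g f∉Γ

  Facts-fresh : ∀ l {f} → f ∉ allVars l → All (λ φ → f ∉ fvars φ) (Facts l)
  Facts-fresh (out w) f∉ = (f∉ ∘ output-⊆-allVars (out w)) ∷ []
  Facts-fresh (lett v e l) f∉ = subst (All _) (sym (factsLet-addFactor v e (output l) (Facts l)))
    (All-addFactor-∉ (summedArrow (output l) (arrowVar v))
      ([ f∉ ∘ allVars-FV v e l , f∉ ∘ allVars-pvars v e l ] ∘ ∈-++⁻ (FV e))
      (Facts-fresh l (f∉ ∘ allVars-tail v e l)))

  Facts-local : ∀ l {U} → toExpr l ∶ U → All Local (Facts l)
  Facts-local (out w)      _ = (λ _ _ _ _ _ → ≈-refl) ∷ []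
  Facts-local (lett v e l) (t-let _ e-typed l-typed _ _) =
    subst (All Local) (sym (factsLet-addFactor v e (output l) (Facts l)))
      (Local-addFactor (summedArrow (output l) (arrowVar v)) (Local-Fact v e e-typed) (Facts-local l l-typed))

  Step-output : ∀ {G l l'} → Step G l l' → output l' ≡ output l
  Step-output (S₁ _)             = refl
  Step-output (S₂ _ _ _ _ _ _ _) = refl
  Step-output (S₃ _ _)           = refl
  Step-output (tail step)        = Step-output step

  WellTyped-tail : ∀ v e l → WellTyped (lett v e l) → WellTyped l
  WellTyped-tail v e l ((U , t-let _ _ l-typed _ _) , unique , BV#FV) =
    (U , l-typed) , Unique-++⁻ʳ (BV e) (Unique-++⁻ʳ (pvars v) unique) , BV#FV'
    where
    BV#FV' : Disjoint (BV (toExpr l)) (FV (toExpr l))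
    BV#FV' {y} y∈BV y∈FV with y ∈? pvars v
    ... | yes y∈v = Unique-++⇒Disjoint (pvars v) unique y∈v (∈-++⁺ʳ (BV e) y∈BV)
    ... | no y∉v  = BV#FV (∈-++⁺ʳ (pvars v) (∈-++⁺ʳ (BV e) y∈BV)) (∈-++⁺ʳ (FV e) (∈-∖⁺ y∈FV y∉v))

  record RedexHygiene (v₁ : Pat) (e₁ : Expr) (v₂ : Pat) (e₂ : Expr) (L : Expr) : Set where
    field
      v₁#v₂ : Disjoint (pvars v₁) (pvars v₂)
      v₁#L  : Disjoint (pvars v₁) (BV L)
      e₁#v₁ : Disjoint (FV e₁) (pvars v₁)
      e₁#v₂ : Disjoint (FV e₁) (pvars v₂)
      e₂#v₂ : Disjoint (FV e₂) (pvars v₂)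

  redexHygiene : ∀ v₁ e₁ v₂ e₂ L → Unique (BV (elet v₁ e₁ (elet v₂ e₂ L))) →
                 Disjoint (BV (elet v₁ e₁ (elet v₂ e₂ L))) (FV (elet v₁ e₁ (elet v₂ e₂ L))) →
                 RedexHygiene v₁ e₁ v₂ e₂ L
  redexHygiene v₁ e₁ v₂ e₂ L unique BV#FV = record
    { v₁#v₂ = v₁#v₂
    ; v₁#L  = λ y∈v₁ y∈L → v₁#rest y∈v₁ (∈-++⁺ʳ (BV e₁) (∈-++⁺ʳ (pvars v₂) (∈-++⁺ʳ (BV e₂) y∈L)))
    ; e₁#v₁ = λ y∈e₁ y∈v₁ → BV#FV (∈-++⁺ˡ y∈v₁) (∈-++⁺ˡ y∈e₁)
    ; e₁#v₂ = λ y∈e₁ y∈v₂ → BV#FV (BV-v₂ y∈v₂) (∈-++⁺ˡ y∈e₁)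
    ; e₂#v₂ = e₂#v₂ }
    where
    v₁#rest = Unique-++⇒Disjoint (pvars v₁) unique
    BV-v₂ : pvars v₂ ⊆ BV (elet v₁ e₁ (elet v₂ e₂ L))
    BV-v₂ = ∈-++⁺ʳ (pvars v₁) ∘ ∈-++⁺ʳ (BV e₁) ∘ ∈-++⁺ˡ
    v₁#v₂ : Disjoint (pvars v₁) (pvars v₂)
    v₁#v₂ y∈v₁ y∈v₂ = v₁#rest y∈v₁ (∈-++⁺ʳ (BV e₁) (∈-++⁺ˡ y∈v₂))
    e₂#v₂ : Disjoint (FV e₂) (pvars v₂)
    e₂#v₂ {y} y∈e₂ y∈v₂ with y ∈? pvars v₁
    ... | yes y∈v₁ = v₁#v₂ y∈v₁ y∈v₂
    ... | no y∉v₁  = BV#FV (BV-v₂ y∈v₂) (∈-++⁺ʳ (FV e₁) (∈-∖⁺ (∈-++⁺ˡ y∈e₂) y∉v₁))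

  factsLet₂-addFactor : ∀ v₁ e₁ v₂ e₂ w Γ →
    factsLet v₁ e₁ w (factsLet v₂ e₂ w Γ)
    ≡ addFactor (summedArrow w (arrowVar v₁)) (Fact v₁ e₁)
                (addFactor (summedArrow w (arrowVar v₂)) (Fact v₂ e₂) Γ)
  factsLet₂-addFactor v₁ e₁ v₂ e₂ w Γ =
    trans (factsLet-addFactor v₁ e₁ w _) (cong (addFactor _ (Fact v₁ e₁)) (factsLet-addFactor v₂ e₂ w Γ))

  Facts-swap : ∀ v₁ e₁ v₂ e₂ l {U} → Disjoint (pvars v₁) (FV e₂) → RedexHygiene v₁ e₁ v₂ e₂ (toExpr l) →
               e₁ ∶ pty v₁ → e₂ ∶ pty v₂ → toExpr l ∶ U →
               Facts (lett v₂ e₂ (lett v₁ e₁ l)) ↭ Facts (lett v₁ e₁ (lett v₂ e₂ l))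
  Facts-swap v₁ e₁ v₂ e₂ l v₁#e₂ hygiene e₁-typed e₂-typed l-typed = begin
    factsLet v₂ e₂ w (factsLet v₁ e₁ w Γ)  ≡⟨ factsLet₂-addFactor v₂ e₂ v₁ e₁ w Γ ⟩
    addFactor m₂ F₂ (addFactor m₁ F₁ Γ)    ↭⟨ addFactor-comm m₁ m₂ F₁ F₂ Γ g₁∉F₂ g₂∉F₁ g₁≢g₂
                                                  (Local-Fact v₁ e₁ e₁-typed) (Local-Fact v₂ e₂ e₂-typed)
                                                  (Facts-local l l-typed) ⟩
    addFactor m₁ F₁ (addFactor m₂ F₂ Γ)    ≡⟨ factsLet₂-addFactor v₁ e₁ v₂ e₂ w Γ ⟨
    factsLet v₁ e₁ w (factsLet v₂ e₂ w Γ)  ∎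
    where
    open PermutationReasoning
    open RedexHygiene hygiene
    w = output l
    Γ = Facts l
    F₁ = Fact v₁ e₁
    F₂ = Fact v₂ e₂
    m₁ = summedArrow w (arrowVar v₁)
    m₂ = summedArrow w (arrowVar v₂)
    g₁∉F₂ : ∀ {g} → m₁ ≡ just g → g ∉ fvars F₂
    g₁∉F₂ eq = [ v₁#e₂ (summedArrow-∈ w v₁ eq) , v₁#v₂ (summedArrow-∈ w v₁ eq) ] ∘ ∈-++⁻ (FV e₂)
    g₂∉F₁ : ∀ {g} → m₂ ≡ just g → g ∉ fvars F₁
    g₂∉F₁ eq = [ (λ g∈e₁ → e₁#v₂ g∈e₁ g∈v₂) , (λ g∈v₁ → v₁#v₂ g∈v₁ g∈v₂) ] ∘ ∈-++⁻ (FV e₁)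
      where g∈v₂ = summedArrow-∈ w v₂ eq
    g₁≢g₂ : ∀ {g} → m₁ ≡ just g → m₂ ≢ just g
    g₁≢g₂ eq₁ eq₂ = v₁#v₂ (summedArrow-∈ w v₁ eq₁) (summedArrow-∈ w v₂ eq₂)

  Facts-abstract : ∀ v₁ e₁ v₂ e₂ l x f {U} → RedexHygiene v₁ e₁ v₂ e₂ (toExpr l) →
    e₁ ∶ pty v₁ → e₂ ∶ pty v₂ → toExpr l ∶ U → WfPat x → Pos (pty x) →
    (∀ y → (y ∈ pvars x → y ∈ pvars v₁ × y ∈ FV e₂) × (y ∈ pvars v₁ → y ∈ FV e₂ → y ∈ pvars x)) →
    ty f ≡ pty x ⊸ pty v₂ → f ∉ allVars (lett v₁ e₁ (lett v₂ e₂ l)) →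
    Facts (lett (pv f) (lam x e₂) (lett v₁ e₁ (lett v₂ (app f x) l))) ↭ Facts (lett v₁ e₁ (lett v₂ e₂ l))
  Facts-abstract v₁ e₁ v₂ e₂ l x f hygiene e₁-typed e₂-typed l-typed x-wf x-pos x-spec f-type f∉ = begin
    factsLet (pv f) (lam x e₂) w (factsLet v₁ e₁ w (factsLet v₂ (app f x) w Γ))
      ≡⟨ factsLet-addFactor (pv f) (lam x e₂) w _ ⟩
    addFactor (summedArrow w (arrowVar (pv f))) Λ (factsLet v₁ e₁ w (factsLet v₂ (app f x) w Γ))
      ≡⟨ cong₂ (λ m Δ → addFactor m Λ Δ) f-summed (factsLet₂-addFactor v₁ e₁ v₂ (app f x) w Γ) ⟩
    sumOut f Λ (addFactor m₁ F₁ (addFactor m₂ Ψ Γ))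
      ↭⟨ sumOut-contraction contraction ⟩
    addFactor m₁ F₁ (addFactor m₂ (Fact v₂ e₂) Γ)
      ≡⟨ factsLet₂-addFactor v₁ e₁ v₂ e₂ w Γ ⟨
    factsLet v₁ e₁ w (factsLet v₂ e₂ w Γ) ∎
    where
    open PermutationReasoning
    open RedexHygiene hygiene
    w = output l
    Γ = Facts l
    m₁ = summedArrow w (arrowVar v₁)
    m₂ = summedArrow w (arrowVar v₂)
    F₁ = Fact v₁ e₁
    Λ = Fact (pv f) (lam x e₂)
    Ψ = Fact v₂ (app f x)
    x⊆e₂ : pvars x ⊆ FV e₂
    x⊆e₂ {y} = proj₂ ∘ proj₁ (x-spec y)
    inner : allVars (lett v₂ e₂ l) ⊆ allVars (lett v₁ e₁ (lett v₂ e₂ l))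
    inner = allVars-tail v₁ e₁ (lett v₂ e₂ l)
    f∉v₁ : f ∉ pvars v₁
    f∉v₁ = f∉ ∘ allVars-pvars v₁ e₁ (lett v₂ e₂ l)
    f∉F₁ : f ∉ fvars F₁
    f∉F₁ = [ f∉ ∘ allVars-FV v₁ e₁ (lett v₂ e₂ l) , f∉v₁ ] ∘ ∈-++⁻ (FV e₁)
    f∉v₂ : f ∉ pvars v₂
    f∉v₂ = f∉ ∘ inner ∘ allVars-pvars v₂ e₂ l
    f∉e₂ : f ∉ FV e₂
    f∉e₂ = f∉ ∘ inner ∘ allVars-FV v₂ e₂ l
    f∉l : f ∉ allVars l
    f∉l = f∉ ∘ inner ∘ allVars-tail v₂ e₂ l
    f-summed : summedArrow w (arrowVar (pv f)) ≡ just f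
    f-summed = trans (cong (summedArrow w) (arrowVar-pv f f-type)) (summedArrow-∉ w (f∉l ∘ output-⊆-allVars l))
    Λ-local : Local Λ
    Λ-local = Local-Fact (pv f) (lam x e₂) (subst (lam x e₂ ∶_) (sym f-type) (t-lam x-wf x-pos e₂-typed))
    ≢f : ∀ v {g} → f ∉ pvars v → g ∈ pvars v → g ≢ f
    ≢f v f∉v g∈v g≡f = f∉v (subst (_∈ pvars v) g≡f g∈v)
    independent₂ : Independent f Λ m₂
    independent₂ eq = let g∈v₂ = summedArrow-∈ w v₂ eq in ≢f v₂ f∉v₂ g∈v₂ ,
      [ (λ g∈e₂∖x → e₂#v₂ (proj₁ (∈-∖⁻ {xs = FV e₂} g∈e₂∖x)) g∈v₂) , ≢f v₂ f∉v₂ g∈v₂ ∘ singleton⁻ ]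
      ∘ ∈-++⁻ (FV e₂ ∖ pvars x)
    independent₁ : Independent f Λ m₁
    independent₁ {g} eq = let g∈v₁ = summedArrow-∈ w v₁ eq in ≢f v₁ f∉v₁ g∈v₁ ,
      [ (λ g∈e₂∖x → let g∈e₂ , g∉x = ∈-∖⁻ {xs = FV e₂} g∈e₂∖x in g∉x (proj₂ (x-spec g) g∈v₁ g∈e₂))
      , ≢f v₁ f∉v₁ g∈v₁ ∘ singleton⁻ ]
      ∘ ∈-++⁻ (FV e₂ ∖ pvars x)
    contraction : Contraction f Λ (addFactor m₁ F₁ (addFactor m₂ (Fact v₂ e₂) Γ))
                                  (addFactor m₁ F₁ (addFactor m₂ Ψ Γ))
    contraction = contraction-addFactor m₁ F₁
      (contraction-start m₂ (Σ-Fact-β x e₂ v₂ f f-type e₂-typed x⊆e₂ f∉e₂ f∉v₂) (here refl)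
         (Local-Fact-app v₂ f x) Λ-local (Facts-fresh l f∉l) (Facts-local l l-typed) independent₂)
      f∉F₁ (Local-Fact v₁ e₁ e₁-typed) Λ-local independent₁

  Facts-merge : ∀ v₁ e₁ v₂ e₂ l {f U} → RedexHygiene v₁ e₁ v₂ e₂ (toExpr l) → WfPat v₁ →
    e₁ ∶ pty v₁ → e₂ ∶ pty v₂ → toExpr l ∶ U → Disjoint (FVa e₂) (FVa (toExpr l)) →
    arrowVar v₁ ≡ just f → f ∈ FV e₂ →
    Facts (lett (pairPat (posPart v₁) v₂) (elet v₁ e₁ (pairExpr (posPart v₁) e₂)) l)
    ↭ Facts (lett v₁ e₁ (lett v₂ e₂ l))
  Facts-merge v₁ e₁ v₂ e₂ l {f} hygiene v₁-wf e₁-typed e₂-typed l-typed e₂#l v₁-arrow f∈e₂ = begin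
    factsLet v₁⁺v₂ merged w Γ
      ≡⟨ factsLet-addFactor v₁⁺v₂ merged w Γ ⟩
    addFactor (summedArrow w (arrowVar v₁⁺v₂)) (Fact v₁⁺v₂ merged) Γ
      ≡⟨ cong (λ m → addFactor (summedArrow w m) (Fact v₁⁺v₂ merged) Γ) (arrowVar-pairPat v₁ v₂) ⟩
    addFactor m₂ (Fact v₁⁺v₂ merged) Γ
      ↭⟨ sumOut-contraction contraction ⟨
    sumOut f F₁ (addFactor m₂ F₂ Γ)
      ≡⟨ cong (λ m → addFactor m F₁ (addFactor m₂ F₂ Γ)) f-summed ⟨
    addFactor (summedArrow w (arrowVar v₁)) F₁ (addFactor m₂ F₂ Γ)
      ≡⟨ factsLet₂-addFactor v₁ e₁ v₂ e₂ w Γ ⟨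
    factsLet v₁ e₁ w (factsLet v₂ e₂ w Γ) ∎
    where
    open PermutationReasoning
    open RedexHygiene hygiene
    v₁⁺v₂ = pairPat (posPart v₁) v₂
    merged = elet v₁ e₁ (pairExpr (posPart v₁) e₂)
    w = output l
    Γ = Facts l
    F₁ = Fact v₁ e₁
    F₂ = Fact v₂ e₂
    m₂ = summedArrow w (arrowVar v₂)
    f∈v₁ = proj₁ (arrowVar-just⁻ v₁ v₁-arrow)
    f-arrow = proj₂ (arrowVar-just⁻ v₁ v₁-arrow)
    f∉l : f ∉ allVars l
    f∉l f∈l = [ v₁#L f∈v₁ , (λ f∈L → e₂#l (arrow (FV e₂) f∈e₂) (arrow (FV (toExpr l)) f∈L)) ]
              (∈-++⁻ (BV (toExpr l)) f∈l)
      where arrow = λ xs f∈xs → ∈-arrows⁺ xs f∈xs f-arrow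
    f-summed : summedArrow w (arrowVar v₁) ≡ just f
    f-summed = trans (cong (summedArrow w) v₁-arrow) (summedArrow-∉ w (f∉l ∘ output-⊆-allVars l))
    independent₂ : Independent f F₁ m₂
    independent₂ eq = let g∈v₂ = summedArrow-∈ w v₂ eq in
      (λ g≡f → v₁#v₂ f∈v₁ (subst (_∈ pvars v₂) g≡f g∈v₂)) ,
      [ (λ g∈e₁ → e₁#v₂ g∈e₁ g∈v₂) , (λ g∈v₁ → v₁#v₂ g∈v₁ g∈v₂) ] ∘ ∈-++⁻ (FV e₁)
    contraction : Contraction f F₁ (addFactor m₂ (Fact v₁⁺v₂ merged) Γ) (addFactor m₂ F₂ Γ)
    contraction = contraction-start m₂
      (Σ-Fact-let v₁ e₁ v₂ e₂ v₁-wf v₁-arrow (λ f∈e₁ → e₁#v₁ f∈e₁ f∈v₁) v₁#v₂ e₁-typed e₂-typed)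
      (∈-++⁺ˡ f∈e₂) (Local-Fact v₂ e₂ e₂-typed) (Local-Fact v₁ e₁ e₁-typed)
      (Facts-fresh l f∉l) (Facts-local l l-typed) independent₂

  Facts-step : ∀ {G l l'} → WellTyped l → allVars l ⊆ G → Step G l l' → Facts l' ↭ Facts l
  Facts-step well-typed ⊆G (tail {v} {e} {l} {l'} step) =
    subst (λ w → factsLet v e w (Facts l') ↭ Facts (lett v e l)) (sym (Step-output step))
      (factsLet-cong v e (output l)
        (Facts-step (WellTyped-tail v e l well-typed) (⊆G ∘ allVars-tail v e l) step))
  Facts-step ((_ , t-let _ e₁-typed (t-let _ e₂-typed l-typed _ _) _ _) , unique , BV#FV) _
             (S₁ {v₁} {e₁} {v₂} {e₂} {l} v₁#e₂) =
    Facts-swap v₁ e₁ v₂ e₂ l v₁#e₂ (redexHygiene v₁ e₁ v₂ e₂ (toExpr l) unique BV#FV)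
      e₁-typed e₂-typed l-typed
  Facts-step ((_ , t-let _ e₁-typed (t-let _ e₂-typed l-typed _ _) _ _) , unique , BV#FV) ⊆G
             (S₂ {v₁} {e₁} {v₂} {e₂} {l} x f x-wf x-pos x-spec f-type f∉G) =
    Facts-abstract v₁ e₁ v₂ e₂ l x f (redexHygiene v₁ e₁ v₂ e₂ (toExpr l) unique BV#FV)
      e₁-typed e₂-typed l-typed x-wf x-pos x-spec f-type (f∉G ∘ ⊆G)
  Facts-step ((_ , t-let v₁-wf e₁-typed (t-let _ e₂-typed l-typed e₂#l _) _ _) , unique , BV#FV) _
             (S₃ {v₁} {e₁} {v₂} {e₂} {l} v₁-arrow f∈e₂) =
    Facts-merge v₁ e₁ v₂ e₂ l (redexHygiene v₁ e₁ v₂ e₂ (toExpr l) unique BV#FV) v₁-wf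
      e₁-typed e₂-typed l-typed e₂#l v₁-arrow f∈e₂

  ↭⇒≋ : ∀ {Γ Δ} → Γ ↭ Δ → Γ ≋ Δ
  ↭⇒≋ Γ↭Δ = All.tabulate (↭.∈-resp-↭ Γ↭Δ ∘ ∈⇒∈ₛ) , All.tabulate (↭.∈-resp-↭ (↭-sym Γ↭Δ) ∘ ∈⇒∈ₛ)
    where
    ∈⇒∈ₛ : ∀ {φ Θ} → φ ∈ Θ → Any (φ ≈F_) Θ
    ∈⇒∈ₛ = Any.map λ { refl → ≈F-refl }

lemma1 : ∀ {c ℓ} (R : CommutativeSemiring c ℓ) → let open Lang R in
         ∀ (l l' : LetT) → WellTyped l → l ⟶S l' → Facts l' ≋ Facts l
lemma1 R l l' well-typed step = ↭⇒≋ R (Facts-step R well-typed id step)
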